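{- For $n\geqslant 1$, $$\widehat{B}_{n+1}(x)=(1+x)\widehat{B}_{n}(x)+(1+x^2)\sum_{k=0}^{n-1}\binom{n}{k}2^{n-k}\widehat{B}_{k}(x)\widehat{A}_{n-k}(x).$$
   Context: For a permutation $\pi$ of $[m]$, a position $j\in[m-1]$ is an alternating descent if $j$ is odd and $\pi(j)>\pi(j+1)$, or $j$ is even and $\pi(j)<\pi(j+1)$; $\widehat{A}_m(x)=\sum_{\pi}x^{{\rm altdes}(\pi)}$ summed over permutations of $[m]$, ${\rm altdes}(\pi)$ being the number of alternating descents. Let $\mathcal{S}^B_n$ be the set of signed permutations $\sigma$ of $\{\pm1,\dots,\pm n\}$ with $\sigma(-i)=-\sigma(i)$, written as $\sigma(0)\cdots\sigma(n)$ with $\sigma(0)=0$. A position $j\in\{0,\dots,n-1\}$ is an alternating descent of $\sigma$ if $j$ is even and $\sigma(j)<\sigma(j+1)$, or $j$ is odd and $\sigma(j)>\sigma(j+1)$; $\widehat{B}_n(x)=\sum_{\sigma\in\mathcal{S}^B_n}x^{{\rm altdes}_B(\sigma)}$ with ${\rm altdes}_B$ the number of such positions, and $\widehat B_0(x)=1$. -}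

module Defs where

open import Data.Nat using (ℕ; zero; suc; _+_; _*_; _∸_; _^_)
open import Data.Nat.Combinatorics using (_C_)
open import Data.Integer as ℤ using (ℤ; +_; -_)
open import Data.Bool using (Bool; true; false; not; if_then_else_)
open import Data.List using (List; []; _∷_; map; concatMap; foldr; upTo; replicate; _++_)
open import Relation.Nullary.Decidable using (does)
open import Relation.Binary.PropositionalEquality using (_≡_)

-- Polynomials with natural-number coefficients, as coefficient lists
-- (constant term first).  Equality is coefficientwise (_≈ᴾ_).

Poly : Set
Poly = List ℕ

coeff : Poly → ℕ → ℕ
coeff []       _       = 0
coeff (a ∷ p)  zero    = a
coeff (a ∷ p)  (suc d) = coeff p d

infixl 6 _+ᴾ_
infixl 7 _*ᴾ_ _·ᴾ_

_+ᴾ_ : Poly → Poly → Poly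
[]      +ᴾ q       = q
(a ∷ p) +ᴾ []      = a ∷ p
(a ∷ p) +ᴾ (b ∷ q) = (a + b) ∷ (p +ᴾ q)

_·ᴾ_ : ℕ → Poly → Poly
c ·ᴾ p = map (c *_) p

_*ᴾ_ : Poly → Poly → Poly
[]      *ᴾ q = []
(a ∷ p) *ᴾ q = (a ·ᴾ q) +ᴾ (0 ∷ (p *ᴾ q))

xpow : ℕ → Poly
xpow d = replicate d 0 ++ (1 ∷ [])

sumᴾ : List Poly → Poly
sumᴾ = foldr _+ᴾ_ []

infix 4 _≈ᴾ_
_≈ᴾ_ : Poly → Poly → Set
p ≈ᴾ q = ∀ d → coeff p d ≡ coeff q d

-- Enumeration of permutations of [m] = {1,…,m}, as one-line words
-- π(1) π(2) … π(m).  Each permutation is listed exactly once.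

insertions : ℕ → List ℕ → List (List ℕ)
insertions a []       = (a ∷ []) ∷ []
insertions a (b ∷ xs) = (a ∷ b ∷ xs) ∷ map (b ∷_) (insertions a xs)

perms : ℕ → List (List ℕ)
perms zero    = [] ∷ []
perms (suc m) = concatMap (insertions (suc m)) (perms m)

-- All 2^n sign choices on a word: the signed permutations of [n]
-- written as σ(1) … σ(n).
signings : List ℕ → List (List ℤ)
signings []       = [] ∷ []
signings (a ∷ xs) = concatMap (λ ys → (+ a ∷ ys) ∷ (- (+ a) ∷ ys) ∷ []) (signings xs)

signedPerms : ℕ → List (List ℤ)
signedPerms n = concatMap signings (perms n)

altCount : Bool → List ℤ → ℕ
altCount b []            = 0
altCount b (x ∷ [])      = 0
altCount b (x ∷ y ∷ ws)  =
  (if b then (if does (y ℤ.<? x) then 1 else 0)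
        else (if does (x ℤ.<? y) then 1 else 0))
  + altCount (not b) (y ∷ ws)

-- For π ∈ S_m: position j (1-based) is an alternating descent iff
-- j odd and π(j) > π(j+1), or j even and π(j) < π(j+1).
-- Position j = 1 is descent-type, so flag true.
altdes : List ℕ → ℕ
altdes π = altCount true (map +_ π)

-- For σ ∈ S^B_n written σ(0) σ(1) … σ(n) with σ(0) = 0:
-- position j ∈ {0,…,n-1} counts iff j even and σ(j) < σ(j+1), or
-- j odd and σ(j) > σ(j+1).  Position 0 is ascent-type, so flag false.
altdesB : List ℤ → ℕ
altdesB σ = altCount false (+ 0 ∷ σ)

Ahat : ℕ → Poly
Ahat m = sumᴾ (map (λ π → xpow (altdes π)) (perms m))

Bhat : ℕ → Poly
Bhat n = sumᴾ (map (λ σ → xpow (altdesB σ)) (signedPerms n))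

onePlusX : Poly
onePlusX = 1 ∷ 1 ∷ []

onePlusX² : Poly
onePlusX² = 1 ∷ 0 ∷ 1 ∷ []

-- Every signed permutation of [n + 1] arises exactly once by inserting n + 1 or -(n + 1) into a signed
-- permutation τ of [n].  Inserted at the end, the new letter adds 0 or 1 alternating descent: (1 + x) B̂ₙ.
-- Inserted right after τ(p), p < n, it forms a peak or a valley contributing 0 or 2, while the comparison
-- of τ(p) with τ(p+1) is lost; what remains is altdes_B of the first p letters plus an alternating count
-- of the last n - p letters.  Both pieces only see relative order, so standardizing them (C(n, p) ways to
-- share out the letters, 2^(n-p) free signs on the second piece, negation to fix its parity convention)
-- gives (1 + x²) C(n, p) 2^(n-p) B̂ₚ Â_{n-p}.  All of this is proved for ∑ h(statistic) with arbitrary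
-- h : ℕ → ℕ; coefficients are extracted with h = δ · d.

module Submission where

open import Defs
open import Data.Bool using (Bool; true; false; not; if_then_else_)
open import Data.Empty using (⊥-elim)
open import Data.Integer as ℤ using (ℤ; -_; ∣_∣; -[1+_]; +<+; -<+; -<-)
import Data.Integer.Properties as ℤ
open import Data.Nat using (ℕ; zero; suc; _+_; _*_; _∸_; _^_; _≤_; _<_; _>_; z≤n; s≤s; z<s; s<s)
open import Data.Nat.Combinatorics using (_C_; nCk+nC[k+1]≡[n+1]C[k+1])
open import Data.Nat.Properties
open import Algebra.Properties.CommutativeSemigroup +-commutativeSemigroup using () renaming (interchange to +-interchange)
open import Data.Nat.Tactic.RingSolver using (solve-∀)
open import Data.Product using (_×_; _,_; proj₁; proj₂; map₁; map₂)
open import Data.Sum using (_⊎_; inj₁; inj₂)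
open import Data.List using (List; []; _∷_; map; concatMap; _++_; length; take; drop; zip; upTo; applyDownFrom)
open import Data.List.Properties
  using (concatMap-cong; map-++; map-applyUpTo; length-map; length-++; length-take; length-drop; length-applyDownFrom)
open import Data.List.Relation.Unary.All as All using (All; []; _∷_)
import Data.List.Relation.Unary.All.Properties as All
open import Data.List.Relation.Unary.AllPairs as AllPairs using (AllPairs; []; _∷_)
import Data.List.Relation.Unary.AllPairs.Properties as AllPairs
open import Data.List.Relation.Unary.Linked using (Linked; []; [-]; _∷_)
open import Data.List.Relation.Unary.Linked.Properties using (AllPairs⇒Linked; Linked⇒AllPairs)
open import Data.List.Relation.Unary.Unique.Propositional using (Unique)
import Data.List.Relation.Unary.Unique.Propositional.Properties as Unique
open import Data.List.Relation.Binary.Pointwise using (Pointwise; []; _∷_)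
open import Data.List.Relation.Binary.Permutation.Propositional as ↭ using (_↭_; ↭-sym; ↭⇒↭ₛ)
open import Data.List.Relation.Binary.Permutation.Propositional.Properties using (++⁺ˡ; ↭-length; All-resp-↭)
import Data.List.Relation.Binary.Permutation.Setoid.Properties as Setoid↭
open import Data.List.Relation.Binary.Sublist.Propositional using (_⊆_; []; _∷_; _∷ʳ_)
open import Data.List.Relation.Binary.Sublist.Propositional.Properties using (All-resp-⊆)
open import Data.List.Sort ℤ.≤-decTotalOrder using (sort; sort-↭; sort-↗)
open import Function using (_⇔_; mk⇔)
open import Relation.Nullary.Decidable using (does; does-⇔; dec-true; dec-false)
open import Relation.Binary.PropositionalEquality
open ≡-Reasoning

private variable A B : Set

∑ : List A → (A → ℕ) → ℕ
∑ []       f = 0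
∑ (x ∷ xs) f = f x + ∑ xs f

-- the body of ∑[ x ← xs ] extends as far right as possible: write (∑[ x ← xs ] f x) + c
infix 5 ∑
syntax ∑ xs (λ x → e) = ∑[ x ← xs ] e

∑-++ : (xs ys : List A) (f : A → ℕ) → ∑ (xs ++ ys) f ≡ ∑ xs f + ∑ ys f
∑-++ []       ys f = refl
∑-++ (x ∷ xs) ys f = trans (cong (f x +_) (∑-++ xs ys f)) (sym (+-assoc (f x) _ _))

∑-concatMap : (g : A → List B) (xs : List A) (f : B → ℕ) →
  ∑ (concatMap g xs) f ≡ ∑[ a ← xs ] ∑ (g a) f
∑-concatMap g []       f = refl
∑-concatMap g (x ∷ xs) f = trans (∑-++ (g x) _ f) (cong (∑ (g x) f +_) (∑-concatMap g xs f))

∑-map : (g : A → B) (xs : List A) (f : B → ℕ) → ∑ (map g xs) f ≡ ∑[ a ← xs ] f (g a)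
∑-map g []       f = refl
∑-map g (x ∷ xs) f = cong (f (g x) +_) (∑-map g xs f)

∑-cong : (xs : List A) {f g : A → ℕ} → (∀ a → f a ≡ g a) → ∑ xs f ≡ ∑ xs g
∑-cong []       e = refl
∑-cong (x ∷ xs) e = cong₂ _+_ (e x) (∑-cong xs e)

∑-cong-All : {P : A → Set} {xs : List A} {f g : A → ℕ} →
  All P xs → (∀ {a} → P a → f a ≡ g a) → ∑ xs f ≡ ∑ xs g
∑-cong-All []       e = refl
∑-cong-All (p ∷ ps) e = cong₂ _+_ (e p) (∑-cong-All ps e)

∑-distrib-+ : (xs : List A) (f g : A → ℕ) → ∑[ a ← xs ] (f a + g a) ≡ ∑ xs f + ∑ xs g
∑-distrib-+ []       f g = refl
∑-distrib-+ (x ∷ xs) f g =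
  trans (cong (f x + g x +_) (∑-distrib-+ xs f g)) (+-interchange (f x) (g x) _ _)

∑-distribˡ-* : (c : ℕ) (xs : List A) (f : A → ℕ) → ∑[ a ← xs ] (c * f a) ≡ c * ∑ xs f
∑-distribˡ-* c []       f = sym (*-zeroʳ c)
∑-distribˡ-* c (x ∷ xs) f = trans (cong (c * f x +_) (∑-distribˡ-* c xs f)) (sym (*-distribˡ-+ c (f x) _))

∑-zero : (xs : List A) → ∑[ _ ← xs ] 0 ≡ 0
∑-zero []       = refl
∑-zero (_ ∷ xs) = ∑-zero xs

∑-const : (xs : List A) (c : ℕ) → ∑[ _ ← xs ] c ≡ length xs * c
∑-const []       c = refl
∑-const (x ∷ xs) c = cong (c +_) (∑-const xs c)

∑-comm : (xs : List A) (ys : List B) (f : A → B → ℕ) →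
  ∑[ a ← xs ] ∑[ b ← ys ] f a b ≡ ∑[ b ← ys ] ∑[ a ← xs ] f a b
∑-comm []       ys f = sym (∑-zero ys)
∑-comm (x ∷ xs) ys f = trans (cong (∑ ys (f x) +_) (∑-comm xs ys f)) (sym (∑-distrib-+ ys (f x) _))

-- coefficients of x^e * p in terms of those of p
shift : ℕ → (ℕ → ℕ) → ℕ → ℕ
shift zero    c d       = c d
shift (suc e) c zero    = 0
shift (suc e) c (suc d) = shift e c d

δ : ℕ → ℕ → ℕ
δ e = coeff (xpow e)

-- Ahat m and Bhat n are, definitionally, genPoly (perms m) altdes and genPoly (signedPerms n) altdesB
genPoly : List A → (A → ℕ) → Poly
genPoly xs s = sumᴾ (map (λ a → xpow (s a)) xs)

coeff-+ᴾ : ∀ p q d → coeff (p +ᴾ q) d ≡ coeff p d + coeff q d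
coeff-+ᴾ []      q       d       = refl
coeff-+ᴾ (a ∷ p) []      d       = sym (+-identityʳ _)
coeff-+ᴾ (a ∷ p) (b ∷ q) zero    = refl
coeff-+ᴾ (a ∷ p) (b ∷ q) (suc d) = coeff-+ᴾ p q d

coeff-·ᴾ : ∀ c p d → coeff (c ·ᴾ p) d ≡ c * coeff p d
coeff-·ᴾ c []      d       = sym (*-zeroʳ c)
coeff-·ᴾ c (a ∷ p) zero    = refl
coeff-·ᴾ c (a ∷ p) (suc d) = coeff-·ᴾ c p d

coeff-sumᴾ : ∀ ps d → coeff (sumᴾ ps) d ≡ ∑[ p ← ps ] coeff p d
coeff-sumᴾ []       d = refl
coeff-sumᴾ (p ∷ ps) d = trans (coeff-+ᴾ p (sumᴾ ps) d) (cong (coeff p d +_) (coeff-sumᴾ ps d))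

coeff-∷-*ᴾ : ∀ a p q d → coeff ((a ∷ p) *ᴾ q) d ≡ a * coeff q d + coeff (0 ∷ (p *ᴾ q)) d
coeff-∷-*ᴾ a p q d = trans (coeff-+ᴾ (a ·ᴾ q) _ d) (cong (_+ _) (coeff-·ᴾ a q d))

coeff-*ᴾ-distribʳ-+ᴾ : ∀ p p′ q d → coeff ((p +ᴾ p′) *ᴾ q) d ≡ coeff (p *ᴾ q) d + coeff (p′ *ᴾ q) d
coeff-*ᴾ-distribʳ-+ᴾ []      p′       q d = refl
coeff-*ᴾ-distribʳ-+ᴾ (a ∷ p) []       q d = sym (+-identityʳ _)
coeff-*ᴾ-distribʳ-+ᴾ (a ∷ p) (b ∷ p′) q d = begin
  coeff (((a + b) ∷ (p +ᴾ p′)) *ᴾ q) d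
    ≡⟨ coeff-∷-*ᴾ (a + b) (p +ᴾ p′) q d ⟩
  (a + b) * coeff q d + coeff (0 ∷ ((p +ᴾ p′) *ᴾ q)) d
    ≡⟨ cong₂ _+_ (*-distribʳ-+ (coeff q d) a b) (tail-distrib d) ⟩
  (a * coeff q d + b * coeff q d) + (coeff (0 ∷ (p *ᴾ q)) d + coeff (0 ∷ (p′ *ᴾ q)) d)
    ≡⟨ +-interchange (a * coeff q d) _ _ _ ⟩
  (a * coeff q d + coeff (0 ∷ (p *ᴾ q)) d) + (b * coeff q d + coeff (0 ∷ (p′ *ᴾ q)) d)
    ≡⟨ cong₂ _+_ (coeff-∷-*ᴾ a p q d) (coeff-∷-*ᴾ b p′ q d) ⟨
  coeff ((a ∷ p) *ᴾ q) d + coeff ((b ∷ p′) *ᴾ q) d ∎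
  where
  tail-distrib : ∀ d → coeff (0 ∷ ((p +ᴾ p′) *ᴾ q)) d ≡ coeff (0 ∷ (p *ᴾ q)) d + coeff (0 ∷ (p′ *ᴾ q)) d
  tail-distrib zero    = refl
  tail-distrib (suc d) = coeff-*ᴾ-distribʳ-+ᴾ p p′ q d

coeff-xpow-*ᴾ : ∀ e q d → coeff (xpow e *ᴾ q) d ≡ shift e (coeff q) d
coeff-xpow-*ᴾ zero q d = trans (coeff-∷-*ᴾ 1 [] q d) (trans (cong₂ _+_ (*-identityˡ _) (coeff-0∷[] d)) (+-identityʳ _))
  where
  coeff-0∷[] : ∀ d → coeff (0 ∷ []) d ≡ 0
  coeff-0∷[] zero    = refl
  coeff-0∷[] (suc d) = refl
coeff-xpow-*ᴾ (suc e) q zero    = coeff-∷-*ᴾ 0 (xpow e) q zero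
coeff-xpow-*ᴾ (suc e) q (suc d) = trans (coeff-∷-*ᴾ 0 (xpow e) q (suc d)) (coeff-xpow-*ᴾ e q d)

coeff-genPoly : (xs : List A) (s : A → ℕ) (d : ℕ) → coeff (genPoly xs s) d ≡ ∑[ a ← xs ] δ (s a) d
coeff-genPoly xs s d = trans (coeff-sumᴾ (map (λ a → xpow (s a)) xs) d) (∑-map _ xs (λ p → coeff p d))

coeff-genPoly-*ᴾ : (xs : List A) (s : A → ℕ) (q : Poly) (d : ℕ) →
  coeff (genPoly xs s *ᴾ q) d ≡ ∑[ a ← xs ] shift (s a) (coeff q) d
coeff-genPoly-*ᴾ []       s q d = refl
coeff-genPoly-*ᴾ (a ∷ xs) s q d =
  trans (coeff-*ᴾ-distribʳ-+ᴾ (xpow (s a)) _ q d) (cong₂ _+_ (coeff-xpow-*ᴾ (s a) q d) (coeff-genPoly-*ᴾ xs s q d))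

shift-cong : ∀ e {c c′ : ℕ → ℕ} → (∀ d → c d ≡ c′ d) → ∀ d → shift e c d ≡ shift e c′ d
shift-cong zero    eq d       = eq d
shift-cong (suc e) eq zero    = refl
shift-cong (suc e) eq (suc d) = shift-cong e eq d

shift-∑ : (e : ℕ) (xs : List A) (c : A → ℕ → ℕ) (d : ℕ) →
  shift e (λ d → ∑[ a ← xs ] c a d) d ≡ ∑[ a ← xs ] shift e (c a) d
shift-∑ zero    xs c d       = refl
shift-∑ (suc e) xs c zero    = sym (∑-zero xs)
shift-∑ (suc e) xs c (suc d) = shift-∑ e xs c d

shift-* : ∀ e k (c : ℕ → ℕ) d → shift e (λ d → k * c d) d ≡ k * shift e c d
shift-* zero    k c d       = refl
shift-* (suc e) k c zero    = sym (*-zeroʳ k)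
shift-* (suc e) k c (suc d) = shift-* e k c d

shift-δ : ∀ e f d → shift e (δ f) d ≡ δ (e + f) d
shift-δ zero    f d       = refl
shift-δ (suc e) f zero    = refl
shift-δ (suc e) f (suc d) = shift-δ e f d

shift-coeff-genPoly : ∀ e (xs : List A) (s : A → ℕ) d →
  shift e (coeff (genPoly xs s)) d ≡ ∑[ a ← xs ] δ (e + s a) d
shift-coeff-genPoly e xs s d = begin
  shift e (coeff (genPoly xs s)) d            ≡⟨ shift-cong e (coeff-genPoly xs s) d ⟩
  shift e (λ d → ∑[ a ← xs ] δ (s a) d) d ≡⟨ shift-∑ e xs (λ a → δ (s a)) d ⟩
  ∑[ a ← xs ] shift e (δ (s a)) d         ≡⟨ ∑-cong xs (λ a → shift-δ e (s a) d) ⟩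
  ∑[ a ← xs ] δ (e + s a) d               ∎

-- Arrangements of a list

inserts : A → List A → List (List A)
inserts a []       = (a ∷ []) ∷ []
inserts a (b ∷ xs) = (a ∷ b ∷ xs) ∷ map (b ∷_) (inserts a xs)

arrangements : List A → List (List A)
arrangements []       = [] ∷ []
arrangements (v ∷ vs) = concatMap (inserts v) (arrangements vs)

insertions≡inserts : ∀ a w → insertions a w ≡ inserts a w
insertions≡inserts a []      = refl
insertions≡inserts a (b ∷ w) = cong (λ ws → (a ∷ b ∷ w) ∷ map (b ∷_) ws) (insertions≡inserts a w)

perms≡arrangements : ∀ m → perms m ≡ arrangements (applyDownFrom suc m)
perms≡arrangements zero    = refl
perms≡arrangements (suc m) =
  trans (concatMap-cong (insertions≡inserts (suc m)) (perms m))
        (cong (concatMap (inserts (suc m))) (perms≡arrangements m))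

∑-arrangements-∷ : (v : A) (vs : List A) (F : List A → ℕ) →
  ∑ (arrangements (v ∷ vs)) F ≡ ∑[ s ← arrangements vs ] ∑ (inserts v s) F
∑-arrangements-∷ v vs = ∑-concatMap (inserts v) (arrangements vs)

∑-inserts-∷ : (a c : A) (w : List A) (F : List A → ℕ) →
  ∑ (inserts a (c ∷ w)) F ≡ F (a ∷ c ∷ w) + (∑[ z ← inserts a w ] F (c ∷ z))
∑-inserts-∷ a c w F = cong (F (a ∷ c ∷ w) +_) (∑-map (c ∷_) (inserts a w) F)

inserts-↭ : (a : A) (w : List A) → All (_↭ a ∷ w) (inserts a w)
inserts-↭ a []      = ↭.refl ∷ []
inserts-↭ a (b ∷ w) = ↭.refl ∷ All.map⁺ (All.map (λ p → ↭.trans (↭.prep b p) (↭.swap b a ↭.refl)) (inserts-↭ a w))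

arrangements-↭ : (L : List A) → All (_↭ L) (arrangements L)
arrangements-↭ []       = ↭.refl ∷ []
arrangements-↭ (v ∷ vs) = All.concat⁺ (All.map⁺ (All.map
  (λ s↭vs → All.map (λ p → ↭.trans p (↭.prep v s↭vs)) (inserts-↭ v _)) (arrangements-↭ vs)))

∑-inserts-map : (f : A → B) (a : A) (s : List A) (F : List B → ℕ) →
  ∑ (inserts (f a) (map f s)) F ≡ ∑[ x ← inserts a s ] F (map f x)
∑-inserts-map f a []      F = refl
∑-inserts-map f a (c ∷ s) F = begin
  ∑ (inserts (f a) (f c ∷ map f s)) F
    ≡⟨ ∑-inserts-∷ (f a) (f c) (map f s) F ⟩
  F (f a ∷ f c ∷ map f s) + (∑[ z ← inserts (f a) (map f s) ] F (f c ∷ z))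
    ≡⟨ cong (F (f a ∷ f c ∷ map f s) +_) (∑-inserts-map f a s (λ z → F (f c ∷ z))) ⟩
  F (f a ∷ f c ∷ map f s) + (∑[ x ← inserts a s ] F (f c ∷ map f x))
    ≡⟨ ∑-inserts-∷ a c s (λ x → F (map f x)) ⟨
  ∑[ x ← inserts a (c ∷ s) ] F (map f x) ∎

∑-arrangements-map : (f : A → B) (L : List A) (F : List B → ℕ) →
  ∑ (arrangements (map f L)) F ≡ ∑[ x ← arrangements L ] F (map f x)
∑-arrangements-map f []      F = refl
∑-arrangements-map f (v ∷ L) F = begin
  ∑ (arrangements (f v ∷ map f L)) F                             ≡⟨ ∑-arrangements-∷ (f v) (map f L) F ⟩
  ∑[ s ← arrangements (map f L) ] ∑ (inserts (f v) s) F          ≡⟨ ∑-arrangements-map f L _ ⟩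
  ∑[ x ← arrangements L ] ∑ (inserts (f v) (map f x)) F          ≡⟨ ∑-cong (arrangements L) (λ x → ∑-inserts-map f v x F) ⟩
  ∑[ x ← arrangements L ] ∑[ y ← inserts v x ] F (map f y)       ≡⟨ ∑-arrangements-∷ v L _ ⟨
  ∑[ x ← arrangements (v ∷ L) ] F (map f x)                      ∎

∑-inserts-comm : (a b : A) (w : List A) (F : List A → ℕ) →
  ∑[ y ← inserts b w ] ∑ (inserts a y) F ≡ ∑[ y ← inserts a w ] ∑ (inserts b y) F
∑-inserts-comm a b []      F = cong (_+ 0) (swap-heads (F (a ∷ b ∷ [])) (F (b ∷ a ∷ [])))
  where
  swap-heads : ∀ x y → x + (y + 0) ≡ y + (x + 0)
  swap-heads = solve-∀
∑-inserts-comm a b (c ∷ w) F = begin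
  ∑[ y ← inserts b (c ∷ w) ] ∑ (inserts a y) F
    ≡⟨ expand a b ⟩
  x + (y + p) + (q + (∑[ z ← inserts b w ] ∑[ u ← inserts a z ] F (c ∷ u)))
    ≡⟨ cong (λ r → x + (y + p) + (q + r)) (∑-inserts-comm a b w (λ u → F (c ∷ u))) ⟩
  x + (y + p) + (q + (∑[ z ← inserts a w ] ∑[ u ← inserts b z ] F (c ∷ u)))
    ≡⟨ rearrange x y p q _ ⟩
  y + (x + q) + (p + (∑[ z ← inserts a w ] ∑[ u ← inserts b z ] F (c ∷ u)))
    ≡⟨ expand b a ⟨
  ∑[ y ← inserts a (c ∷ w) ] ∑ (inserts b y) F ∎
  where
  x = F (a ∷ b ∷ c ∷ w)
  y = F (b ∷ a ∷ c ∷ w)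
  p = ∑[ z ← inserts a w ] F (b ∷ c ∷ z)
  q = ∑[ z ← inserts b w ] F (a ∷ c ∷ z)
  rearrange : ∀ x y p q r → x + (y + p) + (q + r) ≡ y + (x + q) + (p + r)
  rearrange = solve-∀
  expand : ∀ a b → ∑[ y ← inserts b (c ∷ w) ] ∑ (inserts a y) F ≡
    F (a ∷ b ∷ c ∷ w) + (F (b ∷ a ∷ c ∷ w) + (∑[ z ← inserts a w ] F (b ∷ c ∷ z)))
    + ((∑[ z ← inserts b w ] F (a ∷ c ∷ z)) + (∑[ z ← inserts b w ] ∑[ u ← inserts a z ] F (c ∷ u)))
  expand a b = trans (∑-inserts-∷ b c w _) (cong₂ _+_
    (trans (∑-inserts-∷ a b (c ∷ w) F) (cong (F (a ∷ b ∷ c ∷ w) +_) (∑-inserts-∷ a c w (λ z → F (b ∷ z)))))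
    (trans (∑-cong (inserts b w) (λ z → ∑-inserts-∷ a c z F)) (∑-distrib-+ (inserts b w) _ _)))

∑-arrangements-↭ : {S S′ : List A} → S ↭ S′ → (F : List A → ℕ) → ∑ (arrangements S) F ≡ ∑ (arrangements S′) F
∑-arrangements-↭ ↭.refl F = refl
∑-arrangements-↭ {S = v ∷ S} {v ∷ S′} (↭.prep v p) F =
  trans (∑-arrangements-∷ v S F) (trans (∑-arrangements-↭ p _) (sym (∑-arrangements-∷ v S′ F)))
∑-arrangements-↭ {S = x ∷ y ∷ S} {y ∷ x ∷ S′} (↭.swap x y p) F = begin
  ∑ (arrangements (x ∷ y ∷ S)) F                                          ≡⟨ ∑-arrangements-∷ x (y ∷ S) F ⟩
  ∑[ s ← arrangements (y ∷ S) ] ∑ (inserts x s) F                          ≡⟨ ∑-arrangements-∷ y S _ ⟩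
  ∑[ t ← arrangements S ] ∑[ s ← inserts y t ] ∑ (inserts x s) F           ≡⟨ ∑-arrangements-↭ p _ ⟩
  ∑[ t ← arrangements S′ ] ∑[ s ← inserts y t ] ∑ (inserts x s) F          ≡⟨ ∑-cong (arrangements S′) (λ t → ∑-inserts-comm x y t F) ⟩
  ∑[ t ← arrangements S′ ] ∑[ s ← inserts x t ] ∑ (inserts y s) F          ≡⟨ ∑-arrangements-∷ x S′ _ ⟨
  ∑[ s ← arrangements (x ∷ S′) ] ∑ (inserts y s) F                         ≡⟨ ∑-arrangements-∷ y (x ∷ S′) F ⟨
  ∑ (arrangements (y ∷ x ∷ S′)) F                                          ∎
∑-arrangements-↭ (↭.trans p q) F = trans (∑-arrangements-↭ p F) (∑-arrangements-↭ q F)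

-- Sign choices

∑-signings-∷ : (a : ℕ) (xs : List ℕ) (F : List ℤ → ℕ) →
  ∑ (signings (a ∷ xs)) F ≡ ∑[ ys ← signings xs ] (F (ℤ.+ a ∷ ys) + F (- (ℤ.+ a) ∷ ys))
∑-signings-∷ a xs F =
  trans (∑-concatMap _ (signings xs) F) (∑-cong (signings xs) (λ ys → cong (F (ℤ.+ a ∷ ys) +_) (+-identityʳ _)))

∑-signings-take-drop : (k : ℕ) (w : List ℕ) (Φ : List ℤ → List ℤ → ℕ) →
  ∑[ s ← signings w ] Φ (take k s) (drop k s) ≡
  ∑[ s₁ ← signings (take k w) ] ∑[ s₂ ← signings (drop k w) ] Φ s₁ s₂
∑-signings-take-drop zero    w       Φ = sym (+-identityʳ _)
∑-signings-take-drop (suc k) []      Φ = sym (+-identityʳ _)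
∑-signings-take-drop (suc k) (a ∷ w) Φ = begin
  ∑[ s ← signings (a ∷ w) ] Φ (take (suc k) s) (drop (suc k) s)
    ≡⟨ ∑-signings-∷ a w _ ⟩
  ∑[ ys ← signings w ] (Φ (ℤ.+ a ∷ take k ys) (drop k ys) + Φ (- (ℤ.+ a) ∷ take k ys) (drop k ys))
    ≡⟨ ∑-distrib-+ (signings w) _ _ ⟩
  (∑[ ys ← signings w ] Φ (ℤ.+ a ∷ take k ys) (drop k ys)) + (∑[ ys ← signings w ] Φ (- (ℤ.+ a) ∷ take k ys) (drop k ys))
    ≡⟨ cong₂ _+_ (∑-signings-take-drop k w (λ x → Φ (ℤ.+ a ∷ x)))
                 (∑-signings-take-drop k w (λ x → Φ (- (ℤ.+ a) ∷ x))) ⟩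
  (∑[ s₁ ← signings (take k w) ] H (ℤ.+ a ∷ s₁)) + (∑[ s₁ ← signings (take k w) ] H (- (ℤ.+ a) ∷ s₁))
    ≡⟨ ∑-distrib-+ (signings (take k w)) _ _ ⟨
  ∑[ s₁ ← signings (take k w) ] (H (ℤ.+ a ∷ s₁) + H (- (ℤ.+ a) ∷ s₁))
    ≡⟨ ∑-signings-∷ a (take k w) H ⟨
  ∑ (signings (a ∷ take k w)) H ∎
  where
  H : List ℤ → ℕ
  H s₁ = ∑[ s₂ ← signings (drop k w) ] Φ s₁ s₂

∑-inserts-signings : (a : ℕ) (w : List ℕ) (F : List ℤ → ℕ) →
  ∑[ x ← inserts a w ] ∑ (signings x) F ≡ ∑[ s ← signings w ] (∑ (inserts (ℤ.+ a) s) F + ∑ (inserts (- (ℤ.+ a)) s) F)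
∑-inserts-signings a [] F = arrange (F (ℤ.+ a ∷ [])) (F (- (ℤ.+ a) ∷ []))
  where
  arrange : ∀ x y → x + (y + 0) + 0 ≡ (x + 0) + (y + 0) + 0
  arrange = solve-∀
∑-inserts-signings a (c ∷ w) F = begin
  ∑[ x ← inserts a (c ∷ w) ] ∑ (signings x) F
    ≡⟨ ∑-inserts-∷ a c w _ ⟩
  ∑ (signings (a ∷ c ∷ w)) F + (∑[ z ← inserts a w ] ∑ (signings (c ∷ z)) F)
    ≡⟨ cong₂ _+_ (trans (∑-signings-∷ a (c ∷ w) F) (∑-signings-∷ c w _))
                 (trans (∑-cong (inserts a w) (λ z → ∑-signings-∷ c z F)) (∑-inserts-signings a w F±c)) ⟩
  (∑[ s ← signings w ] corners s) + (∑[ s ← signings w ] (∑ (inserts a⁺ s) F±c + ∑ (inserts a⁻ s) F±c))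
    ≡⟨ ∑-distrib-+ (signings w) _ _ ⟨
  ∑[ s ← signings w ] (corners s + (∑ (inserts a⁺ s) F±c + ∑ (inserts a⁻ s) F±c))
    ≡⟨ ∑-cong (signings w) regroup ⟩
  ∑[ s ← signings w ] (K (c⁺ ∷ s) + K (c⁻ ∷ s))
    ≡⟨ ∑-signings-∷ c w K ⟨
  ∑ (signings (c ∷ w)) K ∎
  where
  a⁺ = ℤ.+ a
  a⁻ = - (ℤ.+ a)
  c⁺ = ℤ.+ c
  c⁻ = - (ℤ.+ c)
  F±c : List ℤ → ℕ
  F±c t = F (c⁺ ∷ t) + F (c⁻ ∷ t)
  K : List ℤ → ℕ
  K s = ∑ (inserts a⁺ s) F + ∑ (inserts a⁻ s) F
  arrange : ∀ f₁ f₂ f₃ f₄ i₁ i₂ i₃ i₄ →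
    ((f₁ + f₂) + (f₃ + f₄)) + ((i₁ + i₂) + (i₃ + i₄)) ≡ ((f₁ + i₁) + (f₂ + i₃)) + ((f₃ + i₂) + (f₄ + i₄))
  arrange = solve-∀
  corners : List ℤ → ℕ
  corners s = (F (a⁺ ∷ c⁺ ∷ s) + F (a⁻ ∷ c⁺ ∷ s)) + (F (a⁺ ∷ c⁻ ∷ s) + F (a⁻ ∷ c⁻ ∷ s))
  regroup : ∀ s → corners s + (∑ (inserts a⁺ s) F±c + ∑ (inserts a⁻ s) F±c) ≡ K (c⁺ ∷ s) + K (c⁻ ∷ s)
  regroup s = begin
    _ ≡⟨ cong (corners s +_) (cong₂ _+_ (∑-distrib-+ (inserts a⁺ s) (λ t → F (c⁺ ∷ t)) (λ t → F (c⁻ ∷ t)))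
                                  (∑-distrib-+ (inserts a⁻ s) (λ t → F (c⁺ ∷ t)) (λ t → F (c⁻ ∷ t)))) ⟩
    _ ≡⟨ arrange (F (a⁺ ∷ c⁺ ∷ s)) (F (a⁻ ∷ c⁺ ∷ s)) (F (a⁺ ∷ c⁻ ∷ s)) (F (a⁻ ∷ c⁻ ∷ s))
                 (∑[ t ← inserts a⁺ s ] F (c⁺ ∷ t)) (∑[ t ← inserts a⁺ s ] F (c⁻ ∷ t))
                 (∑[ t ← inserts a⁻ s ] F (c⁺ ∷ t)) (∑[ t ← inserts a⁻ s ] F (c⁻ ∷ t)) ⟩
    _ ≡⟨ cong₂ _+_ (cong₂ _+_ (∑-inserts-∷ a⁺ c⁺ s F) (∑-inserts-∷ a⁻ c⁺ s F))
                   (cong₂ _+_ (∑-inserts-∷ a⁺ c⁻ s F) (∑-inserts-∷ a⁻ c⁻ s F)) ⟨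
    K (c⁺ ∷ s) + K (c⁻ ∷ s) ∎

∑-arrangements-signings : (V : List ℕ) (F : List ℤ → ℕ) →
  ∑[ w ← arrangements V ] ∑ (signings w) F ≡ ∑[ S ← signings V ] ∑ (arrangements S) F
∑-arrangements-signings []      F = refl
∑-arrangements-signings (v ∷ V) F = begin
  ∑[ w ← arrangements (v ∷ V) ] ∑ (signings w) F
    ≡⟨ ∑-arrangements-∷ v V _ ⟩
  ∑[ s ← arrangements V ] ∑[ x ← inserts v s ] ∑ (signings x) F
    ≡⟨ ∑-cong (arrangements V) (λ s → ∑-inserts-signings v s F) ⟩
  ∑[ s ← arrangements V ] ∑[ t ← signings s ] (∑ (inserts (ℤ.+ v) t) F + ∑ (inserts (- (ℤ.+ v)) t) F)
    ≡⟨ ∑-arrangements-signings V _ ⟩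
  ∑[ S ← signings V ] ∑[ t ← arrangements S ] (∑ (inserts (ℤ.+ v) t) F + ∑ (inserts (- (ℤ.+ v)) t) F)
    ≡⟨ ∑-cong (signings V) (λ S → trans (∑-distrib-+ (arrangements S) _ _)
         (sym (cong₂ _+_ (∑-arrangements-∷ (ℤ.+ v) S F) (∑-arrangements-∷ (- (ℤ.+ v)) S F)))) ⟩
  ∑[ S ← signings V ] (∑ (arrangements (ℤ.+ v ∷ S)) F + ∑ (arrangements (- (ℤ.+ v) ∷ S)) F)
    ≡⟨ ∑-signings-∷ v V _ ⟨
  ∑[ S ← signings (v ∷ V) ] ∑ (arrangements S) F ∎

signings-∣∣ : (V : List ℕ) → All (λ S → map ∣_∣ S ≡ V) (signings V)
signings-∣∣ []      = refl ∷ []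
signings-∣∣ (v ∷ V) = All.concat⁺ (All.map⁺ (All.map
  (λ e → cong (v ∷_) e ∷ cong₂ _∷_ (ℤ.∣-i∣≡∣i∣ (ℤ.+ v)) e ∷ []) (signings-∣∣ V)))

length-signings : (V : List ℕ) → length (signings V) ≡ 2 ^ length V
length-signings []      = refl
length-signings (v ∷ V) = begin
  length (signings (v ∷ V))   ≡⟨ *-identityʳ _ ⟨
  length (signings (v ∷ V)) * 1 ≡⟨ ∑-const (signings (v ∷ V)) 1 ⟨
  ∑[ _ ← signings (v ∷ V) ] 1 ≡⟨ ∑-signings-∷ v V (λ _ → 1) ⟩
  ∑[ _ ← signings V ] 2        ≡⟨ ∑-const (signings V) 2 ⟩
  length (signings V) * 2      ≡⟨ cong (_* 2) (length-signings V) ⟩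
  2 ^ length V * 2             ≡⟨ *-comm (2 ^ length V) 2 ⟩
  2 ^ suc (length V)           ∎

-- Statistics that only see relative order

Agrees : ℤ × ℤ → ℤ × ℤ → Set
Agrees (a , a′) (b , b′) = (a ℤ.< b) ⇔ (a′ ℤ.< b′)

Concordant : ℤ × ℤ → ℤ × ℤ → Set
Concordant p q = Agrees p q × Agrees q p

concordant-sym : ∀ {p q} → Concordant p q → Concordant q p
concordant-sym (pq , qp) = qp , pq

concordant-< : ∀ {a a′ b b′} → a ℤ.< b → a′ ℤ.< b′ → Concordant (a , a′) (b , b′)
concordant-< a<b a′<b′ = mk⇔ (λ _ → a′<b′) (λ _ → a<b)
                       , mk⇔ (λ b<a → ⊥-elim (ℤ.<-asym a<b b<a)) (λ b′<a′ → ⊥-elim (ℤ.<-asym a′<b′ b′<a′))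

altCount-concordant : ∀ b {z} → Linked Concordant z → altCount b (map proj₁ z) ≡ altCount b (map proj₂ z)
altCount-concordant b     []                 = refl
altCount-concordant b     [-]                = refl
altCount-concordant true  ((_ , qp) ∷ links) =
  cong₂ _+_ (cong (λ t → if t then 1 else 0) (does-⇔ qp (_ ℤ.<? _) (_ ℤ.<? _))) (altCount-concordant false links)
altCount-concordant false ((pq , _) ∷ links) =
  cong₂ _+_ (cong (λ t → if t then 1 else 0) (does-⇔ pq (_ ℤ.<? _) (_ ℤ.<? _))) (altCount-concordant true links)

neg-<-⇔ : ∀ {x y} → (x ℤ.< y) ⇔ (- y ℤ.< - x)
neg-<-⇔ = mk⇔ ℤ.neg-mono-< ℤ.neg-cancel-<

altCount-neg : ∀ b x → altCount b x ≡ altCount (not b) (map -_ x)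
altCount-neg b     []          = refl
altCount-neg b     (x ∷ [])    = refl
altCount-neg true  (x ∷ y ∷ w) = cong₂ _+_
  (cong (λ t → if t then 1 else 0) (does-⇔ neg-<-⇔ (y ℤ.<? x) (- x ℤ.<? - y))) (altCount-neg false (y ∷ w))
altCount-neg false (x ∷ y ∷ w) = cong₂ _+_
  (cong (λ t → if t then 1 else 0) (does-⇔ neg-<-⇔ (x ℤ.<? y) (- y ℤ.<? - x))) (altCount-neg true (y ∷ w))

∑-arrangements-concordant : (Z₀ P : List (ℤ × ℤ)) → AllPairs Concordant (Z₀ ++ P) → (F : ℕ → ℕ) (b : Bool) →
  ∑[ x ← arrangements (map proj₁ P) ] F (altCount b (map proj₁ Z₀ ++ x)) ≡
  ∑[ x ← arrangements (map proj₂ P) ] F (altCount b (map proj₂ Z₀ ++ x))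
∑-arrangements-concordant Z₀ P concordant F b = begin
  ∑[ x ← arrangements (map proj₁ P) ] F (altCount b (map proj₁ Z₀ ++ x))
    ≡⟨ ∑-arrangements-map proj₁ P _ ⟩
  ∑[ z ← arrangements P ] F (altCount b (map proj₁ Z₀ ++ map proj₁ z))
    ≡⟨ ∑-cong-All (arrangements-↭ P) (λ {z} z↭P → cong F (begin
         altCount b (map proj₁ Z₀ ++ map proj₁ z) ≡⟨ cong (altCount b) (map-++ proj₁ Z₀ z) ⟨
         altCount b (map proj₁ (Z₀ ++ z))         ≡⟨ altCount-concordant b (linked z↭P) ⟩
         altCount b (map proj₂ (Z₀ ++ z))         ≡⟨ cong (altCount b) (map-++ proj₂ Z₀ z) ⟩
         altCount b (map proj₂ Z₀ ++ map proj₂ z) ∎)) ⟩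
  ∑[ z ← arrangements P ] F (altCount b (map proj₂ Z₀ ++ map proj₂ z))
    ≡⟨ ∑-arrangements-map proj₂ P _ ⟨
  ∑[ x ← arrangements (map proj₂ P) ] F (altCount b (map proj₂ Z₀ ++ x)) ∎
  where
  open Setoid↭ (setoid (ℤ × ℤ)) using (AllPairs-resp-↭)
  linked : ∀ {z} → z ↭ P → Linked Concordant (Z₀ ++ z)
  linked z↭P = AllPairs⇒Linked (AllPairs-resp-↭ concordant-sym ((λ { refl c → c }) , (λ { refl c → c }))
    (↭⇒↭ₛ (++⁺ˡ Z₀ (↭-sym z↭P))) concordant)

Increasing : List ℤ → Set
Increasing = AllPairs ℤ._<_

sort-increasing : {S : List ℤ} → Unique S → Increasing (sort S)
sort-increasing {S} unique = AllPairs.zipWith (λ (x≤y , x≢y) → ℤ.≤∧≢⇒< x≤y x≢y)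
  (Linked⇒AllPairs ℤ.≤-trans (sort-↗ S) , Setoid↭.Unique-resp-↭ (setoid ℤ) (↭⇒↭ₛ (↭-sym (sort-↭ S))) unique)

All-zip : {A B : Set} {P : A → Set} {Q : B → Set} {xs : List A} {ys : List B} →
  All P xs → All Q ys → All (λ (x , y) → P x × Q y) (zip xs ys)
All-zip []       _        = []
All-zip (_ ∷ _)  []       = []
All-zip (p ∷ ps) (q ∷ qs) = (p , q) ∷ All-zip ps qs

map-proj₁-zip : {A B : Set} (xs : List A) (ys : List B) → length xs ≡ length ys → map proj₁ (zip xs ys) ≡ xs
map-proj₁-zip []       []       _  = refl
map-proj₁-zip (x ∷ xs) (y ∷ ys) eq = cong (x ∷_) (map-proj₁-zip xs ys (cong Data.Nat.pred eq))

map-proj₂-zip : {A B : Set} (xs : List A) (ys : List B) → length xs ≡ length ys → map proj₂ (zip xs ys) ≡ ys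
map-proj₂-zip []       []       _  = refl
map-proj₂-zip (x ∷ xs) (y ∷ ys) eq = cong (y ∷_) (map-proj₂-zip xs ys (cong Data.Nat.pred eq))

AllPairs-zip : {A B : Set} {R : A → A → Set} {S : B → B → Set} {xs : List A} {ys : List B} →
  AllPairs R xs → AllPairs S ys → AllPairs (λ (x , y) (x′ , y′) → R x x′ × S y y′) (zip xs ys)
AllPairs-zip []         _          = []
AllPairs-zip (_ ∷ _)    []         = []
AllPairs-zip (r ∷ rs)   (s ∷ ss)   = All-zip r s ∷ AllPairs-zip rs ss

zip-increasing-concordant : {S T : List ℤ} → Increasing S → Increasing T → AllPairs Concordant (zip S T)
zip-increasing-concordant incS incT = AllPairs.map (λ (s<s′ , t<t′) → concordant-< s<s′ t<t′) (AllPairs-zip incS incT)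

∑-arrangements-distinct : (S T : List ℤ) → Unique S → Unique T → length S ≡ length T → (F : ℕ → ℕ) (b : Bool) →
  ∑[ x ← arrangements S ] F (altCount b x) ≡ ∑[ x ← arrangements T ] F (altCount b x)
∑-arrangements-distinct S T uniqueS uniqueT |S|≡|T| F b = begin
  ∑ (arrangements S) G                         ≡⟨ ∑-arrangements-↭ (sort-↭ S) G ⟨
  ∑ (arrangements (sort S)) G
    ≡⟨ cong (λ L → ∑ (arrangements L) G) (map-proj₁-zip (sort S) (sort T) same-length) ⟨
  ∑ (arrangements (map proj₁ (zip (sort S) (sort T)))) G
    ≡⟨ ∑-arrangements-concordant [] (zip (sort S) (sort T))
         (zip-increasing-concordant (sort-increasing uniqueS) (sort-increasing uniqueT)) F b ⟩
  ∑ (arrangements (map proj₂ (zip (sort S) (sort T)))) G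
    ≡⟨ cong (λ L → ∑ (arrangements L) G) (map-proj₂-zip (sort S) (sort T) same-length) ⟩
  ∑ (arrangements (sort T)) G                  ≡⟨ ∑-arrangements-↭ (sort-↭ T) G ⟩
  ∑ (arrangements T) G                         ∎
  where
  G : List ℤ → ℕ
  G x = F (altCount b x)
  same-length : length (sort S) ≡ length (sort T)
  same-length = trans (↭-length (sort-↭ S)) (trans |S|≡|T| (sym (↭-length (sort-↭ T))))

descending : ℕ → List ℤ
descending m = map ℤ.+_ (applyDownFrom suc m)

unique-descending : ∀ m → Unique (descending m)
unique-descending m = Unique.map⁺ ℤ.+-injective
  (Unique.applyDownFrom⁺₁ suc m (λ j<i _ eq → <⇒≢ j<i (suc-injective (sym eq))))

∑-arrangements-perms : (S : List ℤ) → Unique S → (m : ℕ) → length S ≡ m → (F : ℕ → ℕ) (b : Bool) →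
  ∑[ x ← arrangements S ] F (altCount b x) ≡ ∑[ π ← perms m ] F (altdes π)
∑-arrangements-perms S unique m |S|≡m F true = begin
  ∑[ x ← arrangements S ] F (altCount true x)
    ≡⟨ ∑-arrangements-distinct S (descending m) unique (unique-descending m)
         (trans |S|≡m (sym (trans (length-map ℤ.+_ (applyDownFrom suc m)) (length-applyDownFrom suc m)))) F true ⟩
  ∑[ x ← arrangements (descending m) ] F (altCount true x)
    ≡⟨ ∑-arrangements-map ℤ.+_ (applyDownFrom suc m) _ ⟩
  ∑[ π ← arrangements (applyDownFrom suc m) ] F (altdes π)
    ≡⟨ cong (λ L → ∑[ π ← L ] F (altdes π)) (perms≡arrangements m) ⟨
  ∑[ π ← perms m ] F (altdes π) ∎
∑-arrangements-perms S unique m |S|≡m F false = begin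
  ∑[ x ← arrangements S ] F (altCount false x)           ≡⟨ ∑-cong (arrangements S) (λ x → cong F (altCount-neg false x)) ⟩
  ∑[ x ← arrangements S ] F (altCount true (map -_ x))   ≡⟨ ∑-arrangements-map -_ S _ ⟨
  ∑[ x ← arrangements (map -_ S) ] F (altCount true x)
    ≡⟨ ∑-arrangements-perms (map -_ S) (Unique.map⁺ ℤ.neg-injective unique) m (trans (length-map -_ S) |S|≡m) F true ⟩
  ∑[ π ← perms m ] F (altdes π)                          ∎

Decreasing : List ℕ → Set
Decreasing = AllPairs _>_

∑-arrangements-signings-perms : (V : List ℕ) → Decreasing V → (H : ℕ → ℕ) (b : Bool) →
  ∑[ w ← arrangements V ] ∑[ s ← signings w ] H (altCount b s) ≡ 2 ^ length V * (∑[ π ← perms (length V) ] H (altdes π))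
∑-arrangements-signings-perms V decreasing H b = begin
  ∑[ w ← arrangements V ] ∑[ s ← signings w ] H (altCount b s)
    ≡⟨ ∑-arrangements-signings V _ ⟩
  ∑[ S ← signings V ] ∑[ s ← arrangements S ] H (altCount b s)
    ≡⟨ ∑-cong-All (signings-∣∣ V) (λ {S} ∣S∣≡V →
         ∑-arrangements-perms S (unique ∣S∣≡V) (length V) (trans (sym (length-map ∣_∣ S)) (cong length ∣S∣≡V)) H b) ⟩
  ∑[ _ ← signings V ] ∑[ π ← perms (length V) ] H (altdes π)
    ≡⟨ ∑-const (signings V) _ ⟩
  length (signings V) * (∑[ π ← perms (length V) ] H (altdes π))
    ≡⟨ cong (_* (∑[ π ← perms (length V) ] H (altdes π))) (length-signings V) ⟩
  2 ^ length V * (∑[ π ← perms (length V) ] H (altdes π)) ∎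
  where
  unique : ∀ {S} → map ∣_∣ S ≡ V → Unique S
  unique ∣S∣≡V = Unique.map⁻ (subst Unique (sym ∣S∣≡V) (AllPairs.map (λ u>v u≡v → <-irrefl (sym u≡v) u>v) decreasing))

sign⁺ sign⁻ : ℕ × ℕ → ℤ × ℤ
sign⁺ (u , d) = ℤ.+ u , ℤ.+ d
sign⁻ (u , d) = - ℤ.+ u , - ℤ.+ d

signedPairs : List (ℕ × ℕ) → List (List (ℤ × ℤ))
signedPairs []      = [] ∷ []
signedPairs (q ∷ Q) = concatMap (λ Z → (sign⁺ q ∷ Z) ∷ (sign⁻ q ∷ Z) ∷ []) (signedPairs Q)

∑-signedPairs-∷ : (q : ℕ × ℕ) (Q : List (ℕ × ℕ)) (K : List (ℤ × ℤ) → ℕ) →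
  ∑ (signedPairs (q ∷ Q)) K ≡ ∑[ Z ← signedPairs Q ] (K (sign⁺ q ∷ Z) + K (sign⁻ q ∷ Z))
∑-signedPairs-∷ q Q K =
  trans (∑-concatMap _ (signedPairs Q) K) (∑-cong (signedPairs Q) (λ Z → cong (K (sign⁺ q ∷ Z) +_) (+-identityʳ _)))

∑-signings-proj₁ : (Q : List (ℕ × ℕ)) (K : List ℤ → ℕ) →
  ∑ (signings (map proj₁ Q)) K ≡ ∑[ Z ← signedPairs Q ] K (map proj₁ Z)
∑-signings-proj₁ []      K = refl
∑-signings-proj₁ (q ∷ Q) K =
  trans (∑-signings-∷ (proj₁ q) (map proj₁ Q) K) (trans (∑-signings-proj₁ Q _) (sym (∑-signedPairs-∷ q Q _)))

∑-signings-proj₂ : (Q : List (ℕ × ℕ)) (K : List ℤ → ℕ) →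
  ∑ (signings (map proj₂ Q)) K ≡ ∑[ Z ← signedPairs Q ] K (map proj₂ Z)
∑-signings-proj₂ []      K = refl
∑-signings-proj₂ (q ∷ Q) K =
  trans (∑-signings-∷ (proj₂ q) (map proj₂ Q) K) (trans (∑-signings-proj₂ Q _) (sym (∑-signedPairs-∷ q Q _)))

Signed : ℤ × ℤ → ℕ × ℕ → Set
Signed p q = p ≡ sign⁺ q ⊎ p ≡ sign⁻ q

signedPairs-pointwise : (Q : List (ℕ × ℕ)) → All (λ Z → Pointwise Signed Z Q) (signedPairs Q)
signedPairs-pointwise []      = [] ∷ []
signedPairs-pointwise (q ∷ Q) =
  All.concat⁺ (All.map⁺ (All.map (λ pw → (inj₁ refl ∷ pw) ∷ (inj₂ refl ∷ pw) ∷ []) (signedPairs-pointwise Q)))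

Positive : ℕ × ℕ → Set
Positive (u , d) = 0 < u × 0 < d

Below : ℕ × ℕ → ℕ × ℕ → Set
Below (u , d) (u′ , d′) = u > u′ × d > d′

-neg<+pos : ∀ {u v} → 0 < u → 0 < v → - ℤ.+ u ℤ.< ℤ.+ v
-neg<+pos 0<u 0<v = ℤ.<-trans (ℤ.neg-mono-< (+<+ 0<u)) (+<+ 0<v)

concordant-origin : ∀ {p q} → Signed p q → Positive q → Concordant (ℤ.+ 0 , ℤ.+ 0) p
concordant-origin (inj₁ refl) (0<u , 0<d) = concordant-< (+<+ 0<u) (+<+ 0<d)
concordant-origin (inj₂ refl) (0<u , 0<d) = concordant-sym (concordant-< (ℤ.neg-mono-< (+<+ 0<u)) (ℤ.neg-mono-< (+<+ 0<d)))

concordant-signed : ∀ {p p′ q q′} → Signed p q → Signed p′ q′ → Positive q → Positive q′ → Below q q′ →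
  Concordant p p′
concordant-signed (inj₁ refl) (inj₁ refl) _           _             (u>u′ , d>d′) =
  concordant-sym (concordant-< (+<+ u>u′) (+<+ d>d′))
concordant-signed (inj₁ refl) (inj₂ refl) (0<u , 0<d) (0<u′ , 0<d′) _             =
  concordant-sym (concordant-< (-neg<+pos 0<u′ 0<u) (-neg<+pos 0<d′ 0<d))
concordant-signed (inj₂ refl) (inj₁ refl) (0<u , 0<d) (0<u′ , 0<d′) _             =
  concordant-< (-neg<+pos 0<u 0<u′) (-neg<+pos 0<d 0<d′)
concordant-signed (inj₂ refl) (inj₂ refl) _           _             (u>u′ , d>d′) =
  concordant-< (ℤ.neg-mono-< (+<+ u>u′)) (ℤ.neg-mono-< (+<+ d>d′))

signed-concordant : ∀ {Z Q} → Pointwise Signed Z Q → AllPairs Below Q → All Positive Q →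
  AllPairs Concordant ((ℤ.+ 0 , ℤ.+ 0) ∷ Z)
signed-concordant []         []         []           = [] ∷ []
signed-concordant (s ∷ sZQ) (b ∷ bQ) (pos ∷ posQ) with signed-concordant sZQ bQ posQ
... | origin ∷ concZ = (concordant-origin s pos ∷ origin) ∷ row sZQ b posQ ∷ concZ
  where
  row : ∀ {Z Q} → Pointwise Signed Z Q → All (Below _) Q → All Positive Q → All (Concordant _) Z
  row []          []         []            = []
  row (s′ ∷ sZQ′) (b′ ∷ bQ′) (pos′ ∷ posQ′) = concordant-signed s s′ pos pos′ b′ ∷ row sZQ′ bQ′ posQ′

-- signing U and D with a common sign pattern yields concordant words, even after prefixing 0
∑-arrangements-signings-decreasing : (U D : List ℕ) → Decreasing U → Decreasing D → All (0 <_) U → All (0 <_) D →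
  length U ≡ length D → (G : ℕ → ℕ) →
  ∑[ w ← arrangements U ] ∑[ s ← signings w ] G (altdesB s) ≡ ∑[ w ← arrangements D ] ∑[ s ← signings w ] G (altdesB s)
∑-arrangements-signings-decreasing U D decU decD posU posD |U|≡|D| G = begin
  ∑[ w ← arrangements U ] ∑[ s ← signings w ] G (altdesB s)  ≡⟨ ∑-arrangements-signings U _ ⟩
  ∑ (signings U) K                                           ≡⟨ cong (λ L → ∑ (signings L) K) (map-proj₁-zip U D |U|≡|D|) ⟨
  ∑ (signings (map proj₁ Q)) K                               ≡⟨ ∑-signings-proj₁ Q K ⟩
  ∑[ Z ← signedPairs Q ] K (map proj₁ Z)
    ≡⟨ ∑-cong-All (signedPairs-pointwise Q) (λ sZQ →
         ∑-arrangements-concordant ((ℤ.+ 0 , ℤ.+ 0) ∷ []) _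
           (signed-concordant sZQ (AllPairs-zip decU decD) (All-zip posU posD)) G false) ⟩
  ∑[ Z ← signedPairs Q ] K (map proj₂ Z)                     ≡⟨ ∑-signings-proj₂ Q K ⟨
  ∑ (signings (map proj₂ Q)) K                               ≡⟨ cong (λ L → ∑ (signings L) K) (map-proj₂-zip U D |U|≡|D|) ⟩
  ∑ (signings D) K                                           ≡⟨ ∑-arrangements-signings D _ ⟨
  ∑[ w ← arrangements D ] ∑[ s ← signings w ] G (altdesB s)  ∎
  where
  Q = zip U D
  K : List ℤ → ℕ
  K S = ∑[ s ← arrangements S ] G (altdesB s)

-- Cutting a signed permutation in two

-- pairs (U , U′) of complementary subsequences of V with length U = k
splits : ℕ → List A → List (List A × List A)
splits zero    []      = ([] , []) ∷ []
splits (suc k) []      = []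
splits zero    (v ∷ V) = map (map₂ (v ∷_)) (splits zero V)
splits (suc k) (v ∷ V) = map (map₁ (v ∷_)) (splits k V) ++ map (map₂ (v ∷_)) (splits (suc k) V)

splits-[] : (k : ℕ) (V : List A) → length V < k → splits k V ≡ []
splits-[] (suc k) []      _           = refl
splits-[] (suc k) (v ∷ V) (s≤s |V|<k) rewrite splits-[] k V |V|<k | splits-[] (suc k) V (m<n⇒m<1+n |V|<k) = refl

length-splits : (k : ℕ) (V : List A) → length (splits k V) ≡ length V C k
length-splits zero    []      = refl
length-splits (suc k) []      = refl
length-splits zero    (v ∷ V) = trans (length-map _ (splits zero V)) (length-splits zero V)
length-splits (suc k) (v ∷ V) = begin
  length (map (map₁ (v ∷_)) (splits k V) ++ map (map₂ (v ∷_)) (splits (suc k) V))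
    ≡⟨ length-++ (map (map₁ (v ∷_)) (splits k V)) ⟩
  length (map (map₁ (v ∷_)) (splits k V)) + length (map (map₂ (v ∷_)) (splits (suc k) V))
    ≡⟨ cong₂ _+_ (trans (length-map _ (splits k V)) (length-splits k V))
                 (trans (length-map _ (splits (suc k) V)) (length-splits (suc k) V)) ⟩
  length V C k + length V C suc k
    ≡⟨ nCk+nC[k+1]≡[n+1]C[k+1] (length V) k ⟩
  suc (length V) C suc k ∎

record IsSplit (k : ℕ) (V : List A) (p : List A × List A) : Set where
  field
    left⊆       : proj₁ p ⊆ V
    right⊆      : proj₂ p ⊆ V
    length-left : length (proj₁ p) ≡ k
    length-sum  : length (proj₁ p) + length (proj₂ p) ≡ length V
open IsSplit

isSplit-∷ˡ : ∀ {k V p} (v : A) → IsSplit k V p → IsSplit (suc k) (v ∷ V) (map₁ (v ∷_) p)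
isSplit-∷ˡ v s = record { left⊆ = refl ∷ left⊆ s ; right⊆ = v ∷ʳ right⊆ s
                        ; length-left = cong suc (length-left s) ; length-sum = cong suc (length-sum s) }

isSplit-∷ʳ : ∀ {k V p} (v : A) → IsSplit k V p → IsSplit k (v ∷ V) (map₂ (v ∷_) p)
isSplit-∷ʳ v s = record { left⊆ = v ∷ʳ left⊆ s ; right⊆ = refl ∷ right⊆ s
                        ; length-left = length-left s ; length-sum = trans (+-suc _ _) (cong suc (length-sum s)) }

splits-isSplit : (k : ℕ) (V : List A) → All (IsSplit k V) (splits k V)
splits-isSplit zero    []      = record { left⊆ = [] ; right⊆ = [] ; length-left = refl ; length-sum = refl } ∷ []
splits-isSplit (suc k) []      = []
splits-isSplit zero    (v ∷ V) = All.map⁺ (All.map (isSplit-∷ʳ v) (splits-isSplit zero V))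
splits-isSplit (suc k) (v ∷ V) =
  All.++⁺ (All.map⁺ (All.map (isSplit-∷ˡ v) (splits-isSplit k V))) (All.map⁺ (All.map (isSplit-∷ʳ v) (splits-isSplit (suc k) V)))

AllPairs-resp-⊆ : {R : A → A → Set} {xs ys : List A} → xs ⊆ ys → AllPairs R ys → AllPairs R xs
AllPairs-resp-⊆ []         []       = []
AllPairs-resp-⊆ (y ∷ʳ sub) (_ ∷ rs) = AllPairs-resp-⊆ sub rs
AllPairs-resp-⊆ (refl ∷ sub) (r ∷ rs) = All-resp-⊆ sub r ∷ AllPairs-resp-⊆ sub rs

∑-split : (List A → List A → ℕ) → List A × List A → ℕ
∑-split Φ (U , U′) = ∑[ a ← arrangements U ] ∑[ c ← arrangements U′ ] Φ a c

∑-split-insert-left : (v : A) (Φ : List A → List A → ℕ) (p : List A × List A) →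
  ∑-split (λ a b → ∑[ a′ ← inserts v a ] Φ a′ b) p ≡ ∑-split Φ (map₁ (v ∷_) p)
∑-split-insert-left v Φ (U , U′) =
  trans (∑-cong (arrangements U) (λ a → ∑-comm (arrangements U′) (inserts v a) (λ c a′ → Φ a′ c)))
        (sym (∑-arrangements-∷ v U _))

∑-split-insert-right : (v : A) (Φ : List A → List A → ℕ) (p : List A × List A) →
  ∑-split (λ a b → ∑[ b′ ← inserts v b ] Φ a b′) p ≡ ∑-split Φ (map₂ (v ∷_) p)
∑-split-insert-right v Φ (U , U′) = ∑-cong (arrangements U) (λ a → sym (∑-arrangements-∷ v U′ (Φ a)))

-- v lands either among the first j + 1 letters or after them
∑-inserts-take-drop : (v : A) (j : ℕ) (w : List A) → j < length w → (Φ : List A → List A → ℕ) →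
  ∑[ x ← inserts v w ] Φ (take (suc j) x) (drop (suc j) x) ≡
  (∑[ a ← inserts v (take j w) ] Φ a (drop j w)) + (∑[ b ← inserts v (drop (suc j) w) ] Φ (take (suc j) w) b)
∑-inserts-take-drop v zero    (c ∷ w) _           Φ =
  trans (∑-inserts-∷ v c w _) (cong (_+ ∑ (inserts v w) (Φ (c ∷ []))) (sym (+-identityʳ (Φ (v ∷ []) (c ∷ w)))))
∑-inserts-take-drop v (suc j) (c ∷ w) (s≤s j<|w|) Φ = begin
  ∑[ x ← inserts v (c ∷ w) ] Φ (take (suc (suc j)) x) (drop (suc (suc j)) x)
    ≡⟨ ∑-inserts-∷ v c w _ ⟩
  Φ (v ∷ c ∷ take j w) (drop j w) + (∑[ z ← inserts v w ] Φ (c ∷ take (suc j) z) (drop (suc j) z))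
    ≡⟨ cong (Φ (v ∷ c ∷ take j w) (drop j w) +_) (∑-inserts-take-drop v j w j<|w| (λ a → Φ (c ∷ a))) ⟩
  Φ (v ∷ c ∷ take j w) (drop j w) + (L + R)
    ≡⟨ +-assoc (Φ (v ∷ c ∷ take j w) (drop j w)) L R ⟨
  Φ (v ∷ c ∷ take j w) (drop j w) + L + R
    ≡⟨ cong (_+ R) (∑-inserts-∷ v c (take j w) (λ a → Φ a (drop j w))) ⟨
  (∑[ a ← inserts v (c ∷ take j w) ] Φ a (drop j w)) + R ∎
  where
  L = ∑[ a ← inserts v (take j w) ] Φ (c ∷ a) (drop j w)
  R = ∑[ b ← inserts v (drop (suc j) w) ] Φ (c ∷ take (suc j) w) b

∑-inserts-take-drop-end : (v : A) (w : List A) (Φ : List A → List A → ℕ) →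
  ∑[ x ← inserts v w ] Φ (take (suc (length w)) x) (drop (suc (length w)) x) ≡
  ∑[ a ← inserts v (take (length w) w) ] Φ a (drop (length w) w)
∑-inserts-take-drop-end v []      Φ = refl
∑-inserts-take-drop-end v (c ∷ w) Φ =
  trans (∑-inserts-∷ v c w _) (trans (cong (Φ (v ∷ c ∷ take (length w) w) (drop (length w) w) +_)
                                            (∑-inserts-take-drop-end v w (λ a → Φ (c ∷ a))))
                                      (sym (∑-inserts-∷ v c (take (length w) w) _)))

∑-arrangements-take-drop : (k : ℕ) (V : List A) → k ≤ length V → (Φ : List A → List A → ℕ) →
  ∑[ w ← arrangements V ] Φ (take k w) (drop k w) ≡ ∑ (splits k V) (∑-split Φ)
∑-arrangements-take-drop zero    []      _ Φ = sym (trans (+-identityʳ _) (+-identityʳ _))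
∑-arrangements-take-drop zero    (v ∷ V) _ Φ = begin
  ∑[ w ← arrangements (v ∷ V) ] Φ [] w                   ≡⟨ ∑-arrangements-∷ v V _ ⟩
  ∑[ s ← arrangements V ] ∑[ w ← inserts v s ] Φ [] w    ≡⟨ ∑-arrangements-take-drop zero V z≤n _ ⟩
  ∑ (splits zero V) (∑-split (λ a b → ∑[ b′ ← inserts v b ] Φ a b′))
    ≡⟨ ∑-cong (splits zero V) (∑-split-insert-right v Φ) ⟩
  ∑[ p ← splits zero V ] ∑-split Φ (map₂ (v ∷_) p)       ≡⟨ ∑-map _ (splits zero V) _ ⟨
  ∑ (splits zero (v ∷ V)) (∑-split Φ)                    ∎
∑-arrangements-take-drop (suc j) (v ∷ V) (s≤s j≤|V|) Φ with m≤n⇒m<n∨m≡n j≤|V|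
... | inj₁ j<|V| = begin
  ∑[ w ← arrangements (v ∷ V) ] Φ (take (suc j) w) (drop (suc j) w)
    ≡⟨ ∑-arrangements-∷ v V _ ⟩
  ∑[ s ← arrangements V ] ∑[ w ← inserts v s ] Φ (take (suc j) w) (drop (suc j) w)
    ≡⟨ ∑-cong-All (arrangements-↭ V) (λ s↭V → ∑-inserts-take-drop v j _ (subst (j <_) (sym (↭-length s↭V)) j<|V|) Φ) ⟩
  ∑[ s ← arrangements V ] (Φ₁ (take j s) (drop j s) + Φ₂ (take (suc j) s) (drop (suc j) s))
    ≡⟨ ∑-distrib-+ (arrangements V) _ _ ⟩
  (∑[ s ← arrangements V ] Φ₁ (take j s) (drop j s)) + (∑[ s ← arrangements V ] Φ₂ (take (suc j) s) (drop (suc j) s))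
    ≡⟨ cong₂ _+_ (∑-arrangements-take-drop j V (<⇒≤ j<|V|) Φ₁) (∑-arrangements-take-drop (suc j) V j<|V| Φ₂) ⟩
  ∑ (splits j V) (∑-split Φ₁) + ∑ (splits (suc j) V) (∑-split Φ₂)
    ≡⟨ cong₂ _+_ (split-left j) (split-right (suc j)) ⟩
  ∑ (map (map₁ (v ∷_)) (splits j V)) (∑-split Φ) + ∑ (map (map₂ (v ∷_)) (splits (suc j) V)) (∑-split Φ)
    ≡⟨ ∑-++ (map (map₁ (v ∷_)) (splits j V)) _ (∑-split Φ) ⟨
  ∑ (splits (suc j) (v ∷ V)) (∑-split Φ) ∎
  where
  Φ₁ Φ₂ : List _ → List _ → ℕ
  Φ₁ a b = ∑[ a′ ← inserts v a ] Φ a′ b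
  Φ₂ a b = ∑[ b′ ← inserts v b ] Φ a b′
  split-left : ∀ k → ∑ (splits k V) (∑-split Φ₁) ≡ ∑ (map (map₁ (v ∷_)) (splits k V)) (∑-split Φ)
  split-left k = trans (∑-cong (splits k V) (∑-split-insert-left v Φ)) (sym (∑-map _ (splits k V) _))
  split-right : ∀ k → ∑ (splits k V) (∑-split Φ₂) ≡ ∑ (map (map₂ (v ∷_)) (splits k V)) (∑-split Φ)
  split-right k = trans (∑-cong (splits k V) (∑-split-insert-right v Φ)) (sym (∑-map _ (splits k V) _))
... | inj₂ refl = begin
  ∑[ w ← arrangements (v ∷ V) ] Φ (take (suc j) w) (drop (suc j) w)
    ≡⟨ ∑-arrangements-∷ v V _ ⟩
  ∑[ s ← arrangements V ] ∑[ w ← inserts v s ] Φ (take (suc j) w) (drop (suc j) w)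
    ≡⟨ ∑-cong-All (arrangements-↭ V) (λ {s} s↭V → subst (λ m → ∑[ w ← inserts v s ] Φ (take (suc m) w) (drop (suc m) w)
                                                                ≡ ∑[ a ← inserts v (take m s) ] Φ a (drop m s))
                                                         (↭-length s↭V) (∑-inserts-take-drop-end v s Φ)) ⟩
  ∑[ s ← arrangements V ] Φ₁ (take j s) (drop j s)
    ≡⟨ ∑-arrangements-take-drop j V j≤|V| Φ₁ ⟩
  ∑ (splits j V) (∑-split Φ₁)
    ≡⟨ trans (∑-cong (splits j V) (∑-split-insert-left v Φ)) (sym (∑-map _ (splits j V) _)) ⟩
  ∑ (map (map₁ (v ∷_)) (splits j V)) (∑-split Φ)
    ≡⟨ +-identityʳ _ ⟨
  ∑ (map (map₁ (v ∷_)) (splits j V)) (∑-split Φ) + ∑ (map (map₂ (v ∷_)) []) (∑-split Φ)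
    ≡⟨ cong (λ S → ∑ (map (map₁ (v ∷_)) (splits j V)) (∑-split Φ) + ∑ (map (map₂ (v ∷_)) S) (∑-split Φ))
            (splits-[] (suc j) V ≤-refl) ⟨
  ∑ (map (map₁ (v ∷_)) (splits j V)) (∑-split Φ) + ∑ (map (map₂ (v ∷_)) (splits (suc j) V)) (∑-split Φ)
    ≡⟨ ∑-++ (map (map₁ (v ∷_)) (splits j V)) _ (∑-split Φ) ⟨
  ∑ (splits (suc j) (v ∷ V)) (∑-split Φ) ∎
  where
  Φ₁ : List _ → List _ → ℕ
  Φ₁ a b = ∑[ a′ ← inserts v a ] Φ a′ b

weight : ℕ → ℕ → ℕ
weight n k = (n C k) * 2 ^ (n ∸ k)

∑B×A : ℕ → ℕ → (ℕ → ℕ) → ℕ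
∑B×A k m h = ∑[ σ ← signedPerms k ] ∑[ π ← perms m ] h (altdesB σ + altdes π)

decreasing-applyDownFrom : ∀ n → Decreasing (applyDownFrom suc n)
decreasing-applyDownFrom n = AllPairs.applyDownFrom⁺₁ suc n (λ j<i _ → s<s j<i)

positive-applyDownFrom : ∀ n → All (0 <_) (applyDownFrom suc n)
positive-applyDownFrom n = All.applyDownFrom⁺₂ suc n (λ _ → z<s)

∑-signedPerms : (k : ℕ) (f : List ℤ → ℕ) →
  ∑ (signedPerms k) f ≡ ∑[ a ← arrangements (applyDownFrom suc k) ] ∑ (signings a) f
∑-signedPerms k f =
  trans (∑-concatMap signings (perms k) f) (cong (λ L → ∑[ a ← L ] ∑ (signings a) f) (perms≡arrangements k))

-- standardizing: the first piece is a signed permutation of [k], the second a permutation of [n - k] with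
-- free signs, and the letters are shared out in C(n, k) ways
∑-signedPerms-take-drop : (n k : ℕ) → k ≤ n → (g : ℕ → ℕ) (b : Bool) →
  ∑[ τ ← signedPerms n ] g (altdesB (take k τ) + altCount b (drop k τ)) ≡ weight n k * ∑B×A k (n ∸ k) g
∑-signedPerms-take-drop n k k≤n g b = begin
  ∑[ τ ← signedPerms n ] Φ (take k τ) (drop k τ)
    ≡⟨ ∑-signedPerms n _ ⟩
  ∑[ w ← arrangements [n…1] ] ∑[ τ ← signings w ] Φ (take k τ) (drop k τ)
    ≡⟨ ∑-cong (arrangements [n…1]) (λ w → ∑-signings-take-drop k w Φ) ⟩
  ∑[ w ← arrangements [n…1] ] Ψ (take k w) (drop k w)
    ≡⟨ ∑-arrangements-take-drop k [n…1] (subst (k ≤_) (sym (length-applyDownFrom suc n)) k≤n) Ψ ⟩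
  ∑ (splits k [n…1]) (∑-split Ψ)
    ≡⟨ ∑-cong-All (splits-isSplit k [n…1]) ∑-split-standard ⟩
  ∑[ _ ← splits k [n…1] ] 2 ^ (n ∸ k) * ∑B×A k (n ∸ k) g
    ≡⟨ ∑-const (splits k [n…1]) _ ⟩
  length (splits k [n…1]) * (2 ^ (n ∸ k) * ∑B×A k (n ∸ k) g)
    ≡⟨ cong (_* (2 ^ (n ∸ k) * ∑B×A k (n ∸ k) g)) (trans (length-splits k [n…1]) (cong (_C k) (length-applyDownFrom suc n))) ⟩
  (n C k) * (2 ^ (n ∸ k) * ∑B×A k (n ∸ k) g)
    ≡⟨ *-assoc (n C k) _ _ ⟨
  weight n k * ∑B×A k (n ∸ k) g ∎
  where
  [n…1] = applyDownFrom suc n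
  m = n ∸ k
  Φ : List ℤ → List ℤ → ℕ
  Φ s₁ s₂ = g (altdesB s₁ + altCount b s₂)
  Ψ : List ℕ → List ℕ → ℕ
  Ψ a c = ∑[ s₁ ← signings a ] ∑[ s₂ ← signings c ] Φ s₁ s₂
  ∑-split-standard : ∀ {p} → IsSplit k [n…1] p → ∑-split Ψ p ≡ 2 ^ m * ∑B×A k m g
  ∑-split-standard {U , U′} split = begin
    ∑[ a ← arrangements U ] ∑[ c ← arrangements U′ ] Ψ a c
      ≡⟨ ∑-cong (arrangements U) (λ a → ∑-comm (arrangements U′) (signings a) _) ⟩
    ∑[ a ← arrangements U ] ∑[ s₁ ← signings a ] R (altdesB s₁)
      ≡⟨ ∑-arrangements-signings-decreasing U (applyDownFrom suc k)
           (AllPairs-resp-⊆ (left⊆ split) (decreasing-applyDownFrom n)) (decreasing-applyDownFrom k)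
           (All-resp-⊆ (left⊆ split) (positive-applyDownFrom n)) (positive-applyDownFrom k)
           (trans (length-left split) (sym (length-applyDownFrom suc k))) R ⟩
    ∑[ a ← arrangements (applyDownFrom suc k) ] ∑[ s₁ ← signings a ] R (altdesB s₁)
      ≡⟨ ∑-cong (arrangements (applyDownFrom suc k)) (λ a → trans (∑-cong (signings a) (λ s₁ → R-standard (altdesB s₁)))
                                                                    (∑-distribˡ-* (2 ^ m) (signings a) _)) ⟩
    ∑[ a ← arrangements (applyDownFrom suc k) ] 2 ^ m * (∑[ s₁ ← signings a ] Y (altdesB s₁))
      ≡⟨ ∑-distribˡ-* (2 ^ m) (arrangements (applyDownFrom suc k)) _ ⟩
    2 ^ m * (∑[ a ← arrangements (applyDownFrom suc k) ] ∑[ s₁ ← signings a ] Y (altdesB s₁))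
      ≡⟨ cong (2 ^ m *_) (∑-signedPerms k _) ⟨
    2 ^ m * ∑B×A k m g ∎
    where
    R Y : ℕ → ℕ
    R e = ∑[ c ← arrangements U′ ] ∑[ s₂ ← signings c ] g (e + altCount b s₂)
    Y e = ∑[ π ← perms m ] g (e + altdes π)
    length-right : length U′ ≡ m
    length-right = trans (sym (m+n∸m≡n (length U) (length U′)))
                         (cong₂ _∸_ (trans (length-sum split) (length-applyDownFrom suc n)) (length-left split))
    R-standard : ∀ e → R e ≡ 2 ^ m * Y e
    R-standard e = trans (∑-arrangements-signings-perms U′ (AllPairs-resp-⊆ (right⊆ split) (decreasing-applyDownFrom n)) (λ x → g (e + x)) b)
                         (cong (λ j → 2 ^ j * (∑[ π ← perms j ] g (e + altdes π))) length-right)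

-- Inserting a new largest letter

flips : ℕ → Bool → Bool
flips zero    b = b
flips (suc k) b = not (flips k b)

flips-not : ∀ k b → flips k (not b) ≡ not (flips k b)
flips-not zero    b = refl
flips-not (suc k) b = cong not (flips-not k b)

lastOr : ℤ → List ℤ → ℤ
lastOr c []      = c
lastOr c (l ∷ L) = lastOr l L

altCount-++ : ∀ b c L y R →
  altCount b (c ∷ L ++ y ∷ R) ≡ altCount b (c ∷ L) + altCount (flips (length L) b) (lastOr c L ∷ y ∷ R)
altCount-++ b c []      y R = refl
altCount-++ b c (l ∷ L) y R rewrite altCount-++ (not b) l L y R | flips-not (length L) b =
  sym (+-assoc first (altCount (not b) (l ∷ L)) (altCount (not (flips (length L) b)) (lastOr l L ∷ y ∷ R)))
  where first = if b then (if does (l ℤ.<? c) then 1 else 0) else (if does (c ℤ.<? l) then 1 else 0)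

+-suc-suc : ∀ m n → m + suc (suc n) ≡ 2 + (m + n)
+-suc-suc m n = trans (+-suc m (suc n)) (cong suc (+-suc m n))

Between : ℤ → ℤ → Set
Between M x = - M ℤ.< x × x ℤ.< M

module _ {M : ℤ} where

  peak+valley-last : (h : ℕ → ℕ) (base : ℕ) (b : Bool) {x : ℤ} → Between M x →
    h (base + altCount b (x ∷ M ∷ [])) + h (base + altCount b (x ∷ - M ∷ [])) ≡ h base + h (1 + base)
  peak+valley-last h base true  {x} (-M<x , x<M)
    rewrite dec-false (M ℤ.<? x) (ℤ.<-asym x<M) | dec-true (- M ℤ.<? x) -M<x =
    cong₂ (λ a b → h a + h b) (+-identityʳ base) (+-comm base 1)
  peak+valley-last h base false {x} (-M<x , x<M)
    rewrite dec-true (x ℤ.<? M) x<M | dec-false (x ℤ.<? - M) (ℤ.<-asym -M<x) =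
    trans (+-comm (h (base + 1)) _) (cong₂ (λ a b → h a + h b) (+-identityʳ base) (+-comm base 1))

  -- the peak at M and the valley at - M contribute 0 and 2 alternating descents, in some order
  peak+valley : (h : ℕ → ℕ) (base : ℕ) (b : Bool) {x : ℤ} (D : List ℤ) → 0 < length D → Between M x → All (Between M) D →
    h (base + altCount b (x ∷ M ∷ D)) + h (base + altCount b (x ∷ - M ∷ D))
    ≡ h (base + altCount b D) + h (2 + (base + altCount b D))
  peak+valley h base true  {x} (r ∷ R) _ (-M<x , x<M) ((-M<r , r<M) ∷ _)
    rewrite dec-false (M ℤ.<? x) (ℤ.<-asym x<M) | dec-false (M ℤ.<? r) (ℤ.<-asym r<M)
          | dec-true (- M ℤ.<? x) -M<x | dec-true (- M ℤ.<? r) -M<r =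
    cong (λ k → h (base + altCount true (r ∷ R)) + h k) (+-suc-suc base _)
  peak+valley h base false {x} (r ∷ R) _ (-M<x , x<M) ((-M<r , r<M) ∷ _)
    rewrite dec-true (x ℤ.<? M) x<M | dec-true (r ℤ.<? M) r<M
          | dec-false (x ℤ.<? - M) (ℤ.<-asym -M<x) | dec-false (r ℤ.<? - M) (ℤ.<-asym -M<r) =
    trans (+-comm (h (base + suc (suc C))) _) (cong (λ k → h (base + C) + h k) (+-suc-suc base C))
    where C = altCount false (r ∷ R)

∑-upTo-suc : (n : ℕ) (G : ℕ → ℕ) → ∑ (upTo (suc n)) G ≡ G 0 + (∑[ p ← upTo n ] G (suc p))
∑-upTo-suc n G = cong (G 0 +_) (trans (cong (λ L → ∑ L G) (sym (map-applyUpTo (λ i → i) suc n))) (∑-map suc (upTo n) G))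

∑-inserts-positions : (a : ℤ) (s : List ℤ) (g : List ℤ → ℕ) →
  ∑ (inserts a s) g ≡ (∑[ p ← upTo (length s) ] g (take p s ++ a ∷ drop p s)) + g (s ++ a ∷ [])
∑-inserts-positions a []      g = +-identityʳ _
∑-inserts-positions a (c ∷ s) g = begin
  ∑ (inserts a (c ∷ s)) g
    ≡⟨ ∑-inserts-∷ a c s g ⟩
  g (a ∷ c ∷ s) + (∑[ z ← inserts a s ] g (c ∷ z))
    ≡⟨ cong (g (a ∷ c ∷ s) +_) (∑-inserts-positions a s (λ z → g (c ∷ z))) ⟩
  g (a ∷ c ∷ s) + ((∑[ p ← upTo (length s) ] g (c ∷ take p s ++ a ∷ drop p s)) + g (c ∷ s ++ a ∷ []))
    ≡⟨ +-assoc (g (a ∷ c ∷ s)) _ _ ⟨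
  g (a ∷ c ∷ s) + (∑[ p ← upTo (length s) ] g (c ∷ take p s ++ a ∷ drop p s)) + g (c ∷ s ++ a ∷ [])
    ≡⟨ cong (_+ g (c ∷ s ++ a ∷ [])) (∑-upTo-suc (length s) (λ p → g (take p (c ∷ s) ++ a ∷ drop p (c ∷ s)))) ⟨
  (∑[ p ← upTo (length (c ∷ s)) ] g (take p (c ∷ s) ++ a ∷ drop p (c ∷ s))) + g (c ∷ s ++ a ∷ []) ∎

lastOr-All : {P : ℤ → Set} (c : ℤ) (L : List ℤ) → P c → All P L → P (lastOr c L)
lastOr-All c []      pc _          = pc
lastOr-All c (l ∷ L) pc (pl ∷ pL) = lastOr-All l L pl pL

-- the alternating descents of τ, ignoring the comparison of τ(p) with τ(p+1)
altdesB-split : ℕ → List ℤ → ℕ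
altdesB-split p τ = altdesB (take p τ) + altCount (flips p false) (drop p τ)

∑-inserts-extremes : {M : ℤ} (h : ℕ → ℕ) (τ : List ℤ) → Between M (ℤ.+ 0) → All (Between M) τ →
  (∑[ σ ← inserts M τ ] h (altdesB σ)) + (∑[ σ ← inserts (- M) τ ] h (altdesB σ))
  ≡ (h (altdesB τ) + h (1 + altdesB τ)) + (∑[ p ← upTo (length τ) ] (h (altdesB-split p τ) + h (2 + altdesB-split p τ)))
∑-inserts-extremes {M} h τ between₀ between = begin
  ∑ (inserts M τ) f + ∑ (inserts (- M) τ) f
    ≡⟨ cong₂ _+_ (∑-inserts-positions M τ f) (∑-inserts-positions (- M) τ f) ⟩
  (inner M + end M) + (inner (- M) + end (- M))
    ≡⟨ +-interchange (inner M) (end M) (inner (- M)) (end (- M)) ⟩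
  (inner M + inner (- M)) + (end M + end (- M))
    ≡⟨ +-comm (inner M + inner (- M)) _ ⟩
  (end M + end (- M)) + (inner M + inner (- M))
    ≡⟨ cong₂ _+_ at-end (trans (sym (∑-distrib-+ (upTo (length τ)) _ _)) (∑-cong-All (All.all-upTo (length τ)) inside)) ⟩
  (h (altdesB τ) + h (1 + altdesB τ)) + (∑[ p ← upTo (length τ) ] (h (altdesB-split p τ) + h (2 + altdesB-split p τ))) ∎
  where
  f : List ℤ → ℕ
  f σ = h (altdesB σ)
  τ⟨_⟩ : ℕ → ℤ → List ℤ
  τ⟨ p ⟩ a = take p τ ++ a ∷ drop p τ
  inner end : ℤ → ℕ
  inner a = ∑[ p ← upTo (length τ) ] f (τ⟨ p ⟩ a)
  end a = f (τ ++ a ∷ [])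
  at-end : end M + end (- M) ≡ h (altdesB τ) + h (1 + altdesB τ)
  at-end = trans (cong₂ _+_ (cong h (altCount-++ false (ℤ.+ 0) τ M [])) (cong h (altCount-++ false (ℤ.+ 0) τ (- M) [])))
                 (peak+valley-last h (altdesB τ) (flips (length τ) false) (lastOr-All (ℤ.+ 0) τ between₀ between))
  inside : ∀ {p} → p < length τ → f (τ⟨ p ⟩ M) + f (τ⟨ p ⟩ (- M)) ≡ h (altdesB-split p τ) + h (2 + altdesB-split p τ)
  inside {p} p<|τ| = begin
    f (τ⟨ p ⟩ M) + f (τ⟨ p ⟩ (- M))
      ≡⟨ cong₂ _+_ (cong h (altCount-++ false (ℤ.+ 0) (take p τ) M (drop p τ)))
                   (cong h (altCount-++ false (ℤ.+ 0) (take p τ) (- M) (drop p τ))) ⟩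
    h (prefix + altCount b (x ∷ M ∷ drop p τ)) + h (prefix + altCount b (x ∷ - M ∷ drop p τ))
      ≡⟨ peak+valley h prefix b (drop p τ) (subst (0 <_) (sym (length-drop p τ)) (m<n⇒0<n∸m p<|τ|))
           (lastOr-All (ℤ.+ 0) (take p τ) between₀ (All.take⁺ p between)) (All.drop⁺ p between) ⟩
    h (prefix + altCount b (drop p τ)) + h (2 + (prefix + altCount b (drop p τ)))
      ≡⟨ cong (λ j → h (prefix + altCount (flips j false) (drop p τ)) + h (2 + (prefix + altCount (flips j false) (drop p τ))))
              (trans (length-take p τ) (m≤n⇒m⊓n≡m (<⇒≤ p<|τ|))) ⟩
    h (altdesB-split p τ) + h (2 + altdesB-split p τ) ∎
    where
    prefix = altdesB (take p τ)
    b = flips (length (take p τ)) false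
    x = lastOr (ℤ.+ 0) (take p τ)

∣∣≤⇒between : ∀ {n} x → ∣ x ∣ ≤ n → Between (ℤ.+ suc n) x
∣∣≤⇒between (ℤ.+ k)  k≤n     = -<+ , +<+ (s≤s k≤n)
∣∣≤⇒between -[1+ k ] suc-k≤n = -<- suc-k≤n , -<+

signedPerms-between : ∀ n → All (λ τ → length τ ≡ n × All (Between (ℤ.+ suc n)) τ) (signedPerms n)
signedPerms-between n = All.concat⁺ (All.map⁺ (All.map per-perm
  (subst (All (_↭ applyDownFrom suc n)) (sym (perms≡arrangements n)) (arrangements-↭ (applyDownFrom suc n)))))
  where
  per-perm : ∀ {π} → π ↭ applyDownFrom suc n → All (λ τ → length τ ≡ n × All (Between (ℤ.+ suc n)) τ) (signings π)
  per-perm {π} π↭ = All.map (λ {τ} ∣τ∣≡π →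
      trans (sym (length-map ∣_∣ τ)) (trans (cong length ∣τ∣≡π) (trans (↭-length π↭) (length-applyDownFrom suc n)))
    , All.map (λ {x} → ∣∣≤⇒between x) (All.map⁻ (subst (All (_≤ n)) (sym ∣τ∣≡π)
        (All-resp-↭ (↭-sym π↭) (All.applyDownFrom⁺₁ suc n (λ i<n → i<n))))))
    (signings-∣∣ π)

∑-signedPerms-suc : (n : ℕ) (f : List ℤ → ℕ) →
  ∑ (signedPerms (suc n)) f ≡ ∑[ τ ← signedPerms n ] (∑ (inserts (ℤ.+ suc n) τ) f + ∑ (inserts (- ℤ.+ suc n) τ) f)
∑-signedPerms-suc n f = begin
  ∑ (signedPerms (suc n)) f
    ≡⟨ ∑-concatMap signings (perms (suc n)) f ⟩
  ∑[ π ← perms (suc n) ] ∑ (signings π) f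
    ≡⟨ ∑-concatMap (insertions (suc n)) (perms n) _ ⟩
  ∑[ π ← perms n ] ∑[ x ← insertions (suc n) π ] ∑ (signings x) f
    ≡⟨ ∑-cong (perms n) (λ π → trans (cong (λ L → ∑[ x ← L ] ∑ (signings x) f) (insertions≡inserts (suc n) π))
                                     (∑-inserts-signings (suc n) π f)) ⟩
  ∑[ π ← perms n ] ∑[ τ ← signings π ] (∑ (inserts (ℤ.+ suc n) τ) f + ∑ (inserts (- ℤ.+ suc n) τ) f)
    ≡⟨ ∑-concatMap signings (perms n) _ ⟨
  ∑[ τ ← signedPerms n ] (∑ (inserts (ℤ.+ suc n) τ) f + ∑ (inserts (- ℤ.+ suc n) τ) f) ∎

altdesB-recurrence : ∀ n (h : ℕ → ℕ) →
  ∑[ σ ← signedPerms (suc n) ] h (altdesB σ) ≡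
    ((∑[ σ ← signedPerms n ] h (altdesB σ)) + (∑[ σ ← signedPerms n ] h (1 + altdesB σ)))
    + ((∑[ k ← upTo n ] weight n k * ∑B×A k (n ∸ k) h) + (∑[ k ← upTo n ] weight n k * ∑B×A k (n ∸ k) (λ e → h (2 + e))))
altdesB-recurrence n h = begin
  ∑[ σ ← signedPerms (suc n) ] h (altdesB σ)               ≡⟨ ∑-signedPerms-suc n _ ⟩
  ∑[ τ ← signedPerms n ] extremes τ                         ≡⟨ ∑-cong-All (signedPerms-between n) extremes-split ⟩
  ∑[ τ ← signedPerms n ] (ends τ + cuts n τ)                ≡⟨ ∑-distrib-+ (signedPerms n) ends (cuts n) ⟩
  ∑ (signedPerms n) ends + ∑ (signedPerms n) (cuts n)
    ≡⟨ cong₂ _+_ (∑-distrib-+ (signedPerms n) _ _) (trans (∑-comm (signedPerms n) (upTo n) _)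
         (trans (∑-cong (upTo n) (λ p → ∑-distrib-+ (signedPerms n) _ _)) (∑-distrib-+ (upTo n) _ _))) ⟩
  boundary + ((∑[ p ← upTo n ] ∑[ τ ← signedPerms n ] h (altdesB-split p τ))
              + (∑[ p ← upTo n ] ∑[ τ ← signedPerms n ] h (2 + altdesB-split p τ)))
    ≡⟨ cong (boundary +_) (cong₂ _+_ (standardize h) (standardize (λ e → h (2 + e)))) ⟩
  boundary + ((∑[ k ← upTo n ] weight n k * ∑B×A k (n ∸ k) h) + (∑[ k ← upTo n ] weight n k * ∑B×A k (n ∸ k) (λ e → h (2 + e)))) ∎
  where
  extremes ends : List ℤ → ℕ
  extremes τ = (∑[ σ ← inserts (ℤ.+ suc n) τ ] h (altdesB σ)) + (∑[ σ ← inserts (- ℤ.+ suc n) τ ] h (altdesB σ))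
  ends τ = h (altdesB τ) + h (1 + altdesB τ)
  cuts : ℕ → List ℤ → ℕ
  cuts m τ = ∑[ p ← upTo m ] (h (altdesB-split p τ) + h (2 + altdesB-split p τ))
  boundary : ℕ
  boundary = (∑[ σ ← signedPerms n ] h (altdesB σ)) + (∑[ σ ← signedPerms n ] h (1 + altdesB σ))
  extremes-split : ∀ {τ} → length τ ≡ n × All (Between (ℤ.+ suc n)) τ → extremes τ ≡ ends τ + cuts n τ
  extremes-split {τ} (|τ|≡n , between) =
    subst (λ m → extremes τ ≡ ends τ + cuts m τ) |τ|≡n (∑-inserts-extremes h τ (-<+ , +<+ z<s) between)
  standardize : (g : ℕ → ℕ) →
    ∑[ p ← upTo n ] ∑[ τ ← signedPerms n ] g (altdesB-split p τ) ≡ ∑[ k ← upTo n ] weight n k * ∑B×A k (n ∸ k) g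
  standardize g = ∑-cong-All (All.all-upTo n) (λ {p} p<n → ∑-signedPerms-take-drop n p (<⇒≤ p<n) g (flips p false))


recurrenceSum : ℕ → Poly
recurrenceSum n = sumᴾ (map (λ k → weight n k ·ᴾ (Bhat k *ᴾ Ahat (n ∸ k))) (upTo n))

coeff-Bhat-*ᴾ-Ahat : ∀ k m d → coeff (Bhat k *ᴾ Ahat m) d ≡ ∑B×A k m (λ e → δ e d)
coeff-Bhat-*ᴾ-Ahat k m d = trans (coeff-genPoly-*ᴾ (signedPerms k) altdesB (Ahat m) d)
  (∑-cong (signedPerms k) (λ σ → shift-coeff-genPoly (altdesB σ) (perms m) altdes d))

shift-∑B×A : ∀ e k m d → shift e (λ d → ∑B×A k m (λ f → δ f d)) d ≡ ∑B×A k m (λ f → δ (e + f) d)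
shift-∑B×A e k m d = trans (shift-∑ e (signedPerms k) _ d) (∑-cong (signedPerms k) λ σ →
  trans (shift-∑ e (perms m) _ d) (∑-cong (perms m) λ π → shift-δ e (altdesB σ + altdes π) d))

shift-coeff-recurrenceSum : ∀ e n d →
  shift e (coeff (recurrenceSum n)) d ≡ ∑[ k ← upTo n ] weight n k * ∑B×A k (n ∸ k) (λ f → δ (e + f) d)
shift-coeff-recurrenceSum e n d = begin
  shift e (coeff (recurrenceSum n)) d
    ≡⟨ shift-cong e coeff-recurrenceSum d ⟩
  shift e (λ d → ∑[ k ← upTo n ] weight n k * ∑B×A k (n ∸ k) (λ f → δ f d)) d
    ≡⟨ shift-∑ e (upTo n) _ d ⟩
  ∑[ k ← upTo n ] shift e (λ d → weight n k * ∑B×A k (n ∸ k) (λ f → δ f d)) d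
    ≡⟨ ∑-cong (upTo n) (λ k → trans (shift-* e (weight n k) _ d) (cong (weight n k *_) (shift-∑B×A e k (n ∸ k) d))) ⟩
  ∑[ k ← upTo n ] weight n k * ∑B×A k (n ∸ k) (λ f → δ (e + f) d) ∎
  where
  coeff-recurrenceSum : ∀ d → coeff (recurrenceSum n) d ≡ ∑[ k ← upTo n ] weight n k * ∑B×A k (n ∸ k) (λ f → δ f d)
  coeff-recurrenceSum d =
    trans (coeff-sumᴾ (map _ (upTo n)) d) (trans (∑-map _ (upTo n) (λ p → coeff p d)) (∑-cong (upTo n) λ k →
      trans (coeff-·ᴾ (weight n k) (Bhat k *ᴾ Ahat (n ∸ k)) d) (cong (weight n k *_) (coeff-Bhat-*ᴾ-Ahat k (n ∸ k) d))))

coeff-1+x-*ᴾ : ∀ q d → coeff (onePlusX *ᴾ q) d ≡ coeff q d + shift 1 (coeff q) d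
coeff-1+x-*ᴾ q d = trans (coeff-genPoly-*ᴾ (0 ∷ 1 ∷ []) (λ e → e) q d) (cong (coeff q d +_) (+-identityʳ _))

coeff-1+x²-*ᴾ : ∀ q d → coeff (onePlusX² *ᴾ q) d ≡ coeff q d + shift 2 (coeff q) d
coeff-1+x²-*ᴾ q d = trans (coeff-genPoly-*ᴾ (0 ∷ 2 ∷ []) (λ e → e) q d) (cong (coeff q d +_) (+-identityʳ _))

mainTheorem8 : ∀ (n : ℕ) → 1 ≤ n →
    Bhat (Data.Nat.suc n) ≈ᴾ
    onePlusX *ᴾ Bhat n
    +ᴾ onePlusX² *ᴾ sumᴾ (map (λ k → ((n C k) Data.Nat.* 2 ^ (n ∸ k)) ·ᴾ (Bhat k *ᴾ Ahat (n ∸ k))) (upTo n))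
mainTheorem8 n _ d = begin
  coeff (Bhat (suc n)) d
    ≡⟨ coeff-genPoly (signedPerms (suc n)) altdesB d ⟩
  ∑[ σ ← signedPerms (suc n) ] δ (altdesB σ) d
    ≡⟨ altdesB-recurrence n (λ e → δ e d) ⟩
  ((∑[ σ ← signedPerms n ] δ (altdesB σ) d) + (∑[ σ ← signedPerms n ] δ (1 + altdesB σ) d))
  + ((∑[ k ← upTo n ] weight n k * ∑B×A k (n ∸ k) (λ e → δ e d))
     + (∑[ k ← upTo n ] weight n k * ∑B×A k (n ∸ k) (λ e → δ (2 + e) d)))
    ≡⟨ cong₂ _+_ (cong₂ _+_ (shift-coeff-genPoly 0 (signedPerms n) altdesB d) (shift-coeff-genPoly 1 (signedPerms n) altdesB d))
                 (cong₂ _+_ (shift-coeff-recurrenceSum 0 n d) (shift-coeff-recurrenceSum 2 n d)) ⟨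
  (coeff (Bhat n) d + shift 1 (coeff (Bhat n)) d) + (coeff (recurrenceSum n) d + shift 2 (coeff (recurrenceSum n)) d)
    ≡⟨ cong₂ _+_ (coeff-1+x-*ᴾ (Bhat n) d) (coeff-1+x²-*ᴾ (recurrenceSum n) d) ⟨
  coeff (onePlusX *ᴾ Bhat n) d + coeff (onePlusX² *ᴾ recurrenceSum n) d
    ≡⟨ coeff-+ᴾ (onePlusX *ᴾ Bhat n) _ d ⟨
  coeff (onePlusX *ᴾ Bhat n +ᴾ onePlusX² *ᴾ recurrenceSum n) d ∎
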